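{- Let $T\in\mathcal T(n,d,p,k)$ be a decision tree and $\mathcal S$ a family of subsets of $\{1,\dots,d\}$. Let $m=\max_{v\in\{ -1,1\}^d}\|T(v)\|$. Then for each $i=1,2,\dots,\binom nk$ there are a real $0\le p_i\le1$ and a decision tree $U_i\in\mathcal T^*(n,d,p_i,0)$ such that $p=\sum_{i=1}^{\binom nk}p_i$ and \[ \|T|_{\mathcal S}\|\le m\sum_{i=1}^{\binom nk}\|U_i|_{\mathcal S}\|. \]
   Context: A decision tree of depth $d$ in variables $x_1,\dots,x_n\in\{ -1,1\}$ is a function $T$ on strings $v\in\{ -1,1\}^{\le d}$ such that for $|v|\le d-1$, $T(v)\in\{1,\dots,n\}$ is the index of the variable queried at node $v$, with $T(\varepsilon),T(v_1),\dots,T(v_1\cdots v_{d-1})$ pairwise distinct for each $v\in\{ -1,1\}^{d-1}$; and for each leaf $v\in\{ -1,1\}^d$, $T(v)$ is a real multilinear polynomial in $x_1,\dots,x_n$ not involving $x_{T(\varepsilon)},\dots,x_{T(v_1\cdots v_{d-1})}$. The density of $T$ is the fraction of leaves with nonzero label. $\mathcal T(n,d,p,k)$ is the set of depth-$d$ trees in $n$ variables of density $p$ in which every leaf label is $0$ or a homogeneous multilinear polynomial of degree $k$; $\mathcal T^*(n,d,p,k)$ is the subset where every nonzero leaf label is $\pm\prod_{i\in S}x_i$ for some $S$ with $|S|=k$ (for $k=0$: labels in $\{ -1,0,1\}$). For a multilinear polynomial $\phi$, $\|\phi\|$ is the sum of absolute values of its coefficients. $T|_{\mathcal S}(x)=\sum_{S\in\mathcal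 S}\sum_{v\in\{ -1,1\}^d}T(v)\,2^{ -d}\prod_{i\in S}v_ix_{T(v_1\cdots v_{i-1})}$. -}

module Defs where

open import Level using (0ℓ)
open import Data.Bool using (Bool; true; false; if_then_else_; not; _xor_)
open import Data.Nat using (ℕ; zero; suc)
open import Data.Fin using (Fin; zero; suc; toℕ)
open import Data.Fin.Subset using (Subset; inside; outside; ⁅_⁆; _∪_; ∣_∣)
open import Data.Vec using (Vec; []; _∷_; lookup; zipWith)
import Data.Vec as Vec
open import Data.List using (List; []; _∷_; map; concatMap; foldr; filter; length; allFin)
open import Data.Bool.ListAction using (any)
open import Data.Product using (Σ; _×_; _,_)
open import Data.Sum using (_⊎_)
open import Relation.Nullary using (¬_; Dec; yes; no)
open import Relation.Nullary.Decidable using (⌊_⌋)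
open import Relation.Binary.PropositionalEquality using (_≡_; _≢_)
open import Relation.Binary.Definitions using (Decidable; DecidableEquality)
open import Relation.Binary.Structures using (IsTotalOrder)
open import Algebra.Structures using (IsCommutativeRing)

record Reals : Set₁ where
  infixl 6 _+_
  infixl 7 _*_
  infix 4 _≤_
  field
    Carrier : Set
    _+_ _*_ : Carrier → Carrier → Carrier
    -_ : Carrier → Carrier
    0# 1# : Carrier
    _⁻¹ : Carrier → Carrier          -- value at 0# is unspecified
    _≤_ : Carrier → Carrier → Set
    isCommutativeRing : IsCommutativeRing _≡_ _+_ _*_ -_ 0# 1#
    0≢1 : 0# ≢ 1#
    inverseʳ : ∀ x → x ≢ 0# → x * (x ⁻¹) ≡ 1#
    isTotalOrder : IsTotalOrder _≡_ _≤_
    _≤?_ : Decidable _≤_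
    _≟_ : DecidableEquality Carrier
    +-mono-≤ : ∀ {x y} z → x ≤ y → x + z ≤ y + z
    *-nonneg : ∀ {x y} → 0# ≤ x → 0# ≤ y → 0# ≤ x * y
    complete : (P : Carrier → Set) → Σ Carrier P →
               Σ Carrier (λ b → ∀ x → P x → x ≤ b) →
               Σ Carrier (λ s → (∀ x → P x → x ≤ s) ×
                                (∀ b → (∀ x → P x → x ≤ b) → s ≤ b))

data Sign : Set where
  minus plus : Sign

allSigns : (d : ℕ) → List (Vec Sign d)
allSigns zero = [] ∷ []
allSigns (suc d) = concatMap (λ w → (minus ∷ w) ∷ (plus ∷ w) ∷ []) (allSigns d)

allSubsets : (n : ℕ) → List (Subset n)
allSubsets zero = [] ∷ []
allSubsets (suc n) = concatMap (λ s → (outside ∷ s) ∷ (inside ∷ s) ∷ []) (allSubsets n)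

-- prefix v_1 ⋯ v_{i-1} of a leaf string, for 0-based index i : Fin d
prefix : ∀ {A : Set} {d} → Vec A d → (i : Fin d) → Vec A (toℕ i)
prefix (x ∷ w) zero = []
prefix (x ∷ w) (suc i) = x ∷ prefix w i

_Δ_ : ∀ {n} → Subset n → Subset n → Subset n
_Δ_ = zipWith _xor_

module _ (ℝ : Reals) where
  open Reals ℝ

  -- Multilinear polynomial in x_1..x_n: coefficient of ∏_{i∈S} x_i for each S.
  Poly : ℕ → Set
  Poly n = Subset n → Carrier

  sumList : List Carrier → Carrier
  sumList = foldr _+_ 0#

  sumFin : (k : ℕ) → (Fin k → Carrier) → Carrier
  sumFin k f = sumList (map f (allFin k))

  ∣_∣ℝ : Carrier → Carrier
  ∣ x ∣ℝ with x ≤? 0#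
  ... | yes _ = - x
  ... | no _ = x

  _⊔ℝ_ : Carrier → Carrier → Carrier
  x ⊔ℝ y with x ≤? y
  ... | yes _ = y
  ... | no _ = x

  fromℕ : ℕ → Carrier
  fromℕ zero = 0#
  fromℕ (suc k) = 1# + fromℕ k

  2^ : ℕ → Carrier
  2^ zero = 1#
  2^ (suc d) = (1# + 1#) * 2^ d

  signVal : Sign → Carrier
  signVal minus = - 1#
  signVal plus = 1#

  ‖_‖ : ∀ {n} → Poly n → Carrier
  ‖_‖ {n} φ = sumList (map (λ S → ∣ φ S ∣ℝ) (allSubsets n))

  IsZeroPoly : ∀ {n} → Poly n → Set
  IsZeroPoly φ = ∀ S → φ S ≡ 0#

  isNonzeroB : ∀ {n} → Poly n → Bool
  isNonzeroB {n} φ = any (λ S → not ⌊ φ S ≟ 0# ⌋) (allSubsets n)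

  Homogeneous : ∀ {n} → ℕ → Poly n → Set
  Homogeneous k φ = ∀ S → φ S ≢ 0# → ∣ S ∣ ≡ k

  SignedMonomial : ∀ {n} → ℕ → Poly n → Set
  SignedMonomial {n} k φ =
    Σ (Subset n) λ S → (∣ S ∣ ≡ k) × ((φ S ≡ 1# ⊎ φ S ≡ - 1#) ×
      (∀ S′ → S′ ≢ S → φ S′ ≡ 0#))

  -- Decision tree of depth d in n variables.
  -- query i v : variable queried at the node v ∈ {-1,1}^i (0 ≤ i ≤ d-1),
  -- leaf v : the polynomial label at leaf v ∈ {-1,1}^d.
  record DTree (n d : ℕ) : Set where
    field
      query : (i : Fin d) → Vec Sign (toℕ i) → Fin n
      leaf : Vec Sign d → Poly n
      distinct : ∀ (w : Vec Sign d) (i j : Fin d) →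
                 query i (prefix w i) ≡ query j (prefix w j) → i ≡ j
      avoid : ∀ (w : Vec Sign d) (i : Fin d) (S : Subset n) →
              leaf w S ≢ 0# → lookup S (query i (prefix w i)) ≡ outside
  open DTree public

  density : ∀ {n d} → DTree n d → Carrier
  density {n} {d} T =
    fromℕ (length (filter (λ w → isNonzeroB (leaf T w) Data.Bool.≟ true) (allSigns d)))
      * (2^ d ⁻¹)

  InT : ∀ {n d} → DTree n d → Carrier → ℕ → Set
  InT T p k = (density T ≡ p) × (∀ w → Homogeneous k (leaf T w))

  InT* : ∀ {n d} → DTree n d → Carrier → ℕ → Set
  InT* T p k = (density T ≡ p) ×
    (∀ w → IsZeroPoly (leaf T w) ⊎ SignedMonomial k (leaf T w))

  -- m = max_v ‖T(v)‖ (norms are ≥ 0 and there is ≥ 1 leaf, so start at 0)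
  maxLeafNorm : ∀ {n d} → DTree n d → Carrier
  maxLeafNorm {n} {d} T = foldr (λ w acc → ‖ leaf T w ‖ ⊔ℝ acc) 0# (allSigns d)

  signProd : ∀ {d} → Vec Sign d → Subset d → Carrier
  signProd {d} w A =
    foldr (λ i acc → if lookup A i then signVal (lookup w i) * acc else acc) 1# (allFin d)

  pathVars : ∀ {n d} → DTree n d → Vec Sign d → Subset d → Subset n
  pathVars {n} {d} T w A =
    foldr (λ i acc → if lookup A i then ⁅ query T i (prefix w i) ⁆ ∪ acc else acc)
          (Vec.replicate n outside) (allFin d)

  -- The product x^Q · T(v) is the multilinear product (x_j² = 1), whose
  -- coefficient at M is T(v)(M Δ Q); since Q is disjoint from the support
  -- of T(v) this is the ordinary product.
  restrict : ∀ {n d} → DTree n d → (Subset d → Bool) → Poly n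
  restrict {n} {d} T 𝒮 M =
    sumList (map (λ A → if 𝒮 A
        then sumList (map (λ w → (2^ d ⁻¹) * (signProd w A * leaf T w (M Δ pathVars T w A)))
                          (allSigns d))
        else 0#) (allSubsets d))

-- Write T(w) = ∑_S c_S(w) x^S and let U_S be T with the constant leaf labels c_S.  Then
-- T|_𝒮 = ∑_S x^S · U_S|_𝒮, so ‖T|_𝒮‖ ≤ ∑_S ‖U_S|_𝒮‖, and after dividing by m every row
-- (c_S(w)/m)_S lies in the unit ℓ¹ ball.  As U_S|_𝒮 depends linearly on the leaf values,
-- ∑_S ‖U_S|_𝒮‖ is convex in each row separately; so the rows can be moved one at a time to a
-- vertex ±e_S* of the ball, with S* in the support of the row, without decreasing the sum.
-- Afterwards a leaf w with T(w) ≠ 0 is nonzero in exactly one U_S, with value ±1 and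
-- |S| = k, while leaves with T(w) = 0 vanish everywhere; hence the densities add up to p.

module Submission where

open import Defs
open import Data.Nat using (ℕ)
open import Data.Nat.Combinatorics using (_C_)
open import Data.Fin using (Fin)
open import Data.Fin.Subset using (Subset)
open import Data.Bool using (Bool)
open import Data.Product using (Σ; _×_)
open import Relation.Binary.PropositionalEquality using (_≡_)

open import Level using (0ℓ)
open import Algebra.Bundles using (CommutativeRing)
open import Data.Bool using (true; false; if_then_else_; T; not)
open import Data.Bool.Properties using (xor-assoc; xor-comm; xor-same; T-≡)
import Data.Bool.Properties as Bool
open import Data.Bool.ListAction using (any)
import Data.Nat as ℕ
import Data.Nat.Properties as ℕ
open import Data.Nat using (zero; suc)
open import Data.Nat.Combinatorics using (nCk+nC[k+1]≡[n+1]C[k+1])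
open import Data.Fin using (cast)
open import Data.Fin.Properties using (cast-is-id)
open import Data.Fin.Subset using (inside; outside; ⊥)
import Data.Fin.Subset as Subset
open import Data.Fin.Subset.Properties using (∣⊥∣≡0)
open import Data.List using (List; []; _∷_; map; foldr; concatMap; filter; length; allFin)
import Data.List as List
open import Data.List.Properties
  using (length-filter; map-tabulate; tabulate-lookup; filter-none; filter-≐)
open import Data.List.Membership.Propositional using (_∈_)
open import Data.List.Relation.Unary.All using (universal)
open import Data.List.Relation.Unary.Any using (here; there)
import Data.List.Relation.Unary.Any as Any
open import Data.List.Relation.Unary.Any.Properties using (any⁺)
open import Data.Product using (_,_; proj₁; proj₂)
open import Data.Sum using (_⊎_; inj₁; inj₂)
open import Data.Vec using (Vec; []; _∷_; lookup)
open import Data.Vec.Properties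
  using (≡-dec; zipWith-assoc; zipWith-comm; ∷-injective; lookup-replicate)
open import Data.Empty using (⊥-elim)
open import Function using (_∘_; _⇔_; mk⇔; Equivalence)
open import Relation.Binary.Bundles using (TotalOrder)
open import Relation.Binary.Definitions using (DecidableEquality)
open import Relation.Binary.PropositionalEquality
  using (_≢_; refl; sym; trans; cong; cong₂; subst; subst₂; _≗_; module ≡-Reasoning)
open import Relation.Nullary using (¬_; Dec; yes; no; does)
open import Relation.Nullary.Decidable using (⌊_⌋)
open import Relation.Unary using (Pred; Decidable)

interleave : {A B : Set} → (A → B) → (A → B) → List A → List B
interleave f g = concatMap (λ x → f x ∷ g x ∷ [])

module _ {A B : Set} (f g : A → B) where

  ∈-interleaveˡ : ∀ {x xs} → x ∈ xs → f x ∈ interleave f g xs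
  ∈-interleaveˡ (here refl) = here refl
  ∈-interleaveˡ (there x∈xs) = there (there (∈-interleaveˡ x∈xs))

  ∈-interleaveʳ : ∀ {x xs} → x ∈ xs → g x ∈ interleave f g xs
  ∈-interleaveʳ (here refl) = there (here refl)
  ∈-interleaveʳ (there x∈xs) = there (there (∈-interleaveʳ x∈xs))

  length-interleave : ∀ xs → length (interleave f g xs) ≡ length xs ℕ.+ length xs
  length-interleave [] = refl
  length-interleave (x ∷ xs) =
    trans (cong (suc ∘ suc) (length-interleave xs)) (cong suc (sym (ℕ.+-suc _ _)))

  length-filter-interleave : ∀ {p} {P : Pred B p} (P? : Decidable P) xs →
    length (filter P? (interleave f g xs)) ≡
    length (filter (P? ∘ f) xs) ℕ.+ length (filter (P? ∘ g) xs)
  length-filter-interleave P? [] = refl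
  length-filter-interleave P? (x ∷ xs) with does (P? (f x))
  ... | true with does (P? (g x))
  ...   | true =
    cong suc (trans (cong suc (length-filter-interleave P? xs)) (sym (ℕ.+-suc _ _)))
  ...   | false = cong suc (length-filter-interleave P? xs)
  length-filter-interleave P? (x ∷ xs) | false with does (P? (g x))
  ...   | true = trans (cong suc (length-filter-interleave P? xs)) (sym (ℕ.+-suc _ _))
  ...   | false = length-filter-interleave P? xs

∈-allSubsets : ∀ {n} (S : Subset n) → S ∈ allSubsets n
∈-allSubsets [] = here refl
∈-allSubsets (outside ∷ S) = ∈-interleaveˡ (outside ∷_) (inside ∷_) (∈-allSubsets S)
∈-allSubsets (inside ∷ S) = ∈-interleaveʳ (outside ∷_) (inside ∷_) (∈-allSubsets S)

∈-allSigns : ∀ {d} (w : Vec Sign d) → w ∈ allSigns d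
∈-allSigns [] = here refl
∈-allSigns (minus ∷ w) = ∈-interleaveˡ (minus ∷_) (plus ∷_) (∈-allSigns w)
∈-allSigns (plus ∷ w) = ∈-interleaveʳ (minus ∷_) (plus ∷_) (∈-allSigns w)

_≟Sign_ : DecidableEquality Sign
minus ≟Sign minus = yes refl
plus ≟Sign plus = yes refl
minus ≟Sign plus = no λ ()
plus ≟Sign minus = no λ ()

ofSize : ∀ {n} k → (S : Subset n) → Dec (Subset.∣ S ∣ ≡ k)
ofSize k S = Subset.∣ S ∣ ℕ.≟ k

length-ofSize : ∀ n k → length (filter (ofSize k) (allSubsets n)) ≡ n C k
length-ofSize zero zero = refl
length-ofSize zero (suc k) = refl
length-ofSize (suc n) zero = begin
  length (filter (ofSize 0) (allSubsets (suc n)))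
    ≡⟨ length-filter-interleave (outside ∷_) (inside ∷_) (ofSize 0) (allSubsets n) ⟩
  length (filter (ofSize 0) (allSubsets n)) ℕ.+
  length (filter (ofSize 0 ∘ (inside ∷_)) (allSubsets n))
    ≡⟨ cong₂ ℕ._+_ (length-ofSize n 0)
                   (cong length (filter-none _ (universal (λ _ ()) (allSubsets n)))) ⟩
  1 ℕ.+ 0 ∎
  where open ≡-Reasoning
length-ofSize (suc n) (suc k) = begin
  length (filter (ofSize (suc k)) (allSubsets (suc n)))
    ≡⟨ length-filter-interleave (outside ∷_) (inside ∷_) (ofSize (suc k)) (allSubsets n) ⟩
  length (filter (ofSize (suc k)) (allSubsets n)) ℕ.+
  length (filter (ofSize (suc k) ∘ (inside ∷_)) (allSubsets n))
    ≡⟨ cong₂ ℕ._+_ (length-ofSize n (suc k))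
         (trans (cong length (filter-≐ _ _ (ℕ.suc-injective , cong suc) (allSubsets n)))
                (length-ofSize n k)) ⟩
  n C suc k ℕ.+ n C k
    ≡⟨ ℕ.+-comm (n C suc k) (n C k) ⟩
  n C k ℕ.+ n C suc k
    ≡⟨ nCk+nC[k+1]≡[n+1]C[k+1] n k ⟩
  suc n C suc k ∎
  where open ≡-Reasoning


_≟ₛ_ : ∀ {n} (X Y : Subset n) → Dec (X ≡ Y)
_≟ₛ_ = ≡-dec Bool._≟_

Δ-rightComm : ∀ {n} (X Y Z : Subset n) → (X Δ Y) Δ Z ≡ (X Δ Z) Δ Y
Δ-rightComm X Y Z = begin
  (X Δ Y) Δ Z ≡⟨ zipWith-assoc xor-assoc X Y Z ⟩
  X Δ (Y Δ Z) ≡⟨ cong (X Δ_) (zipWith-comm xor-comm Y Z) ⟩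
  X Δ (Z Δ Y) ≡⟨ zipWith-assoc xor-assoc X Z Y ⟨
  (X Δ Z) Δ Y ∎
  where open ≡-Reasoning

Δ≡⊥⇔≡ : ∀ {n} (X Y : Subset n) → X Δ Y ≡ ⊥ ⇔ X ≡ Y
Δ≡⊥⇔≡ X Y = mk⇔ (to X Y) (λ { refl → self X })
  where
  to : ∀ {n} (X Y : Subset n) → X Δ Y ≡ ⊥ → X ≡ Y
  to [] [] _ = refl
  to (x ∷ X) (y ∷ Y) eq with ∷-injective eq
  to (false ∷ X) (false ∷ Y) _ | _ , eq = cong (false ∷_) (to X Y eq)
  to (true ∷ X) (true ∷ Y) _ | _ , eq = cong (true ∷_) (to X Y eq)
  self : ∀ {n} (X : Subset n) → X Δ X ≡ ⊥
  self [] = refl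
  self (x ∷ X) = cong₂ _∷_ (xor-same x) (self X)

module Rounding (ℝ : Reals) where
  open Reals ℝ renaming (+-mono-≤ to +-monoˡ-≤)

  commutativeRing : CommutativeRing 0ℓ 0ℓ
  commutativeRing = record { isCommutativeRing = isCommutativeRing }

  open CommutativeRing commutativeRing
    using ( +-comm; +-assoc; *-comm; *-assoc; distribˡ; distribʳ; +-identityˡ; +-identityʳ
          ; *-identityˡ; *-identityʳ; zeroˡ; zeroʳ; -‿inverseˡ; -‿inverseʳ
          ; ring; +-commutativeSemigroup; *-commutativeSemigroup)
  open import Algebra.Properties.CommutativeSemigroup +-commutativeSemigroup
    using () renaming (interchange to +-interchange)
  open import Algebra.Properties.CommutativeSemigroup *-commutativeSemigroup
    using () renaming (x∙yz≈y∙xz to x*[y*z]≡y*[x*z])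
  open import Algebra.Properties.Ring ring
    using (-‿involutive; -0#≈0#; -‿distribˡ-*; -‿distribʳ-*; -‿+-comm; -1*x≈-x)

  totalOrder : TotalOrder 0ℓ 0ℓ 0ℓ
  totalOrder = record { isTotalOrder = isTotalOrder }

  open TotalOrder totalOrder using (poset)
    renaming ( refl to ≤-refl; reflexive to ≤-reflexive; trans to ≤-trans
             ; antisym to ≤-antisym; total to ≤-total)
  open import Relation.Binary.Properties.TotalOrder totalOrder using (≰⇒≥)
  open import Relation.Binary.Reasoning.PartialOrder poset

  +-monoʳ-≤ : ∀ z {x y} → x ≤ y → z + x ≤ z + y
  +-monoʳ-≤ z {x} {y} x≤y = subst₂ _≤_ (+-comm x z) (+-comm y z) (+-monoˡ-≤ z x≤y)

  +-mono-≤ : ∀ {x y u v} → x ≤ y → u ≤ v → x + u ≤ y + v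
  +-mono-≤ {y = y} {u} x≤y u≤v = ≤-trans (+-monoˡ-≤ u x≤y) (+-monoʳ-≤ y u≤v)

  x≤y⇒0≤y-x : ∀ {x y} → x ≤ y → 0# ≤ y + - x
  x≤y⇒0≤y-x {x} {y} x≤y = subst (_≤ y + - x) (-‿inverseʳ x) (+-monoˡ-≤ (- x) x≤y)

  x+[y-x]≡y : ∀ x y → x + (y + - x) ≡ y
  x+[y-x]≡y x y = begin-equality
    x + (y + - x)  ≡⟨ +-comm x (y + - x) ⟩
    y + - x + x    ≡⟨ +-assoc y (- x) x ⟩
    y + (- x + x)  ≡⟨ cong (y +_) (-‿inverseˡ x) ⟩
    y + 0#         ≡⟨ +-identityʳ y ⟩
    y              ∎

  0≤y-x⇒x≤y : ∀ {x y} → 0# ≤ y + - x → x ≤ y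
  0≤y-x⇒x≤y {x} {y} 0≤y-x =
    subst₂ _≤_ (+-identityˡ x) (trans (+-comm (y + - x) x) (x+[y-x]≡y x y))
               (+-monoˡ-≤ x 0≤y-x)

  neg-antimono-≤ : ∀ {x y} → x ≤ y → - y ≤ - x
  neg-antimono-≤ {x} {y} x≤y = 0≤y-x⇒x≤y (subst (0# ≤_) rearrange (x≤y⇒0≤y-x x≤y))
    where
    rearrange : y + - x ≡ - x + - (- y)
    rearrange = trans (+-comm y (- x)) (cong (- x +_) (sym (-‿involutive y)))

  x≤0⇒0≤-x : ∀ {x} → x ≤ 0# → 0# ≤ - x
  x≤0⇒0≤-x x≤0 = subst (_≤ _) -0#≈0# (neg-antimono-≤ x≤0)

  0≤x⇒-x≤0 : ∀ {x} → 0# ≤ x → - x ≤ 0#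
  0≤x⇒-x≤0 0≤x = subst (_ ≤_) -0#≈0# (neg-antimono-≤ 0≤x)

  *-monoˡ-≤-nonNeg : ∀ {z x y} → 0# ≤ z → x ≤ y → z * x ≤ z * y
  *-monoˡ-≤-nonNeg {z} {x} {y} 0≤z x≤y =
    0≤y-x⇒x≤y (subst (0# ≤_) z[y-x]≡zy-zx (*-nonneg 0≤z (x≤y⇒0≤y-x x≤y)))
    where
    z[y-x]≡zy-zx : z * (y + - x) ≡ z * y + - (z * x)
    z[y-x]≡zy-zx = trans (distribˡ z y (- x)) (cong (z * y +_) (sym (-‿distribʳ-* z x)))

  *-monoʳ-≤-nonNeg : ∀ {z x y} → 0# ≤ z → x ≤ y → x * z ≤ y * z
  *-monoʳ-≤-nonNeg {z} {x} {y} 0≤z x≤y =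
    subst₂ _≤_ (*-comm z x) (*-comm z y) (*-monoˡ-≤-nonNeg 0≤z x≤y)

  0≤1 : 0# ≤ 1#
  0≤1 with ≤-total 0# 1#
  ... | inj₁ 0≤1 = 0≤1
  ... | inj₂ 1≤0 = subst (0# ≤_) -1*-1≡1 (*-nonneg (x≤0⇒0≤-x 1≤0) (x≤0⇒0≤-x 1≤0))
    where
    -1*-1≡1 : - 1# * - 1# ≡ 1#
    -1*-1≡1 = trans (-1*x≈-x (- 1#)) (-‿involutive 1#)

  1≰0 : ¬ (1# ≤ 0#)
  1≰0 1≤0 = 0≢1 (≤-antisym 0≤1 1≤0)

  0≤1+1 : 0# ≤ 1# + 1#
  0≤1+1 = subst (_≤ 1# + 1#) (+-identityʳ 0#) (+-mono-≤ 0≤1 0≤1)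

  0≤x+x⇒0≤x : ∀ {x} → 0# ≤ x + x → 0# ≤ x
  0≤x+x⇒0≤x {x} 0≤x+x with ≤-total 0# x
  ... | inj₁ 0≤x = 0≤x
  ... | inj₂ x≤0 = ≤-trans 0≤x+x (subst (x + x ≤_) (+-identityʳ x) (+-monoʳ-≤ x x≤0))

  x⁻¹-nonNeg : ∀ {x} → 0# ≤ x → x ≢ 0# → 0# ≤ x ⁻¹
  x⁻¹-nonNeg {x} 0≤x x≢0 with ≤-total 0# (x ⁻¹)
  ... | inj₁ 0≤x⁻¹ = 0≤x⁻¹
  ... | inj₂ x⁻¹≤0 =
    ⊥-elim (1≰0 (subst₂ _≤_ (inverseʳ x x≢0) (zeroʳ x) (*-monoˡ-≤-nonNeg 0≤x x⁻¹≤0)))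

  x*x⁻¹*y≡y : ∀ {x} y → x ≢ 0# → x * (x ⁻¹ * y) ≡ y
  x*x⁻¹*y≡y {x} y x≢0 = begin-equality
    x * (x ⁻¹ * y)  ≡⟨ *-assoc x (x ⁻¹) y ⟨
    x * x ⁻¹ * y    ≡⟨ cong (_* y) (inverseʳ x x≢0) ⟩
    1# * y          ≡⟨ *-identityˡ y ⟩
    y               ∎

  -1≢0 : - 1# ≢ 0#
  -1≢0 -1≡0 = 0≢1 (trans (sym -0#≈0#) (trans (cong -_ (sym -1≡0)) (-‿involutive 1#)))

  1+1*x≡x+x : ∀ x → (1# + 1#) * x ≡ x + x
  1+1*x≡x+x x = trans (distribʳ x 1# 1#) (cong₂ _+_ (*-identityˡ x) (*-identityˡ x))

  [1-t]x+ty≡x+t[y-x] : ∀ t x y → (1# + - t) * x + t * y ≡ x + t * (y + - x)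
  [1-t]x+ty≡x+t[y-x] t x y = begin-equality
    (1# + - t) * x + t * y         ≡⟨ cong (_+ t * y) (distribʳ x 1# (- t)) ⟩
    (1# * x + - t * x) + t * y     ≡⟨ cong (λ u → (u + - t * x) + t * y) (*-identityˡ x) ⟩
    (x + - t * x) + t * y          ≡⟨ +-assoc x (- t * x) (t * y) ⟩
    x + (- t * x + t * y)          ≡⟨ cong (x +_) (+-comm (- t * x) (t * y)) ⟩
    x + (t * y + - t * x)          ≡⟨ cong (λ u → x + (t * y + u)) (-‿distribˡ-* t x) ⟨
    x + (t * y + - (t * x))        ≡⟨ cong (λ u → x + (t * y + u)) (-‿distribʳ-* t x) ⟩
    x + (t * y + t * - x)          ≡⟨ cong (x +_) (distribˡ t y (- x)) ⟨
    x + t * (y + - x)              ∎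

  *-linearˡ : ∀ k x a y → k * (x + a * y) ≡ k * x + a * (k * y)
  *-linearˡ k x a y = trans (distribˡ k x (a * y)) (cong (k * x +_) (x*[y*z]≡y*[x*z] k a y))

  *-linearʳ : ∀ x a y k → (x + a * y) * k ≡ x * k + a * (y * k)
  *-linearʳ x a y k = trans (distribʳ k x (a * y)) (cong (x * k +_) (*-assoc a y k))

  ∣_∣ : Carrier → Carrier
  ∣_∣ = ∣_∣ℝ ℝ

  ∣x∣-cases : ∀ x → (x ≤ 0# × ∣ x ∣ ≡ - x) ⊎ (0# ≤ x × ∣ x ∣ ≡ x)
  ∣x∣-cases x with x ≤? 0#
  ... | yes x≤0 = inj₁ (x≤0 , refl)
  ... | no x≰0 = inj₂ (≰⇒≥ x≰0 , refl)

  0≤∣x∣ : ∀ x → 0# ≤ ∣ x ∣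
  0≤∣x∣ x with ∣x∣-cases x
  ... | inj₁ (x≤0 , eq) = subst (0# ≤_) (sym eq) (x≤0⇒0≤-x x≤0)
  ... | inj₂ (0≤x , eq) = subst (0# ≤_) (sym eq) 0≤x

  x≤∣x∣ : ∀ x → x ≤ ∣ x ∣
  x≤∣x∣ x with ∣x∣-cases x
  ... | inj₁ (x≤0 , eq) = subst (x ≤_) (sym eq) (≤-trans x≤0 (x≤0⇒0≤-x x≤0))
  ... | inj₂ (_ , eq) = ≤-reflexive (sym eq)

  -x≤∣x∣ : ∀ x → - x ≤ ∣ x ∣
  -x≤∣x∣ x with ∣x∣-cases x
  ... | inj₁ (_ , eq) = ≤-reflexive (sym eq)
  ... | inj₂ (0≤x , eq) = subst (- x ≤_) (sym eq) (≤-trans (0≤x⇒-x≤0 0≤x) 0≤x)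

  ∣x∣≤c : ∀ {x c} → x ≤ c → - x ≤ c → ∣ x ∣ ≤ c
  ∣x∣≤c {x} x≤c -x≤c with ∣x∣-cases x
  ... | inj₁ (_ , eq) = subst (_≤ _) (sym eq) -x≤c
  ... | inj₂ (_ , eq) = subst (_≤ _) (sym eq) x≤c

  ∣x+y∣≤∣x∣+∣y∣ : ∀ x y → ∣ x + y ∣ ≤ ∣ x ∣ + ∣ y ∣
  ∣x+y∣≤∣x∣+∣y∣ x y = ∣x∣≤c (+-mono-≤ (x≤∣x∣ x) (x≤∣x∣ y))
    (subst (_≤ ∣ x ∣ + ∣ y ∣) (-‿+-comm x y) (+-mono-≤ (-x≤∣x∣ x) (-x≤∣x∣ y)))

  ∣x∣≡x : ∀ {x} → 0# ≤ x → ∣ x ∣ ≡ x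
  ∣x∣≡x {x} 0≤x with ∣x∣-cases x
  ... | inj₁ (x≤0 , eq) = trans eq (trans (cong -_ x≡0) (trans -0#≈0# (sym x≡0)))
    where x≡0 = ≤-antisym x≤0 0≤x
  ... | inj₂ (_ , eq) = eq

  ∣0∣≡0 : ∣ 0# ∣ ≡ 0#
  ∣0∣≡0 = ∣x∣≡x ≤-refl

  ∣x∣≡0⇒x≡0 : ∀ {x} → ∣ x ∣ ≡ 0# → x ≡ 0#
  ∣x∣≡0⇒x≡0 {x} ∣x∣≡0 = ≤-antisym
    (≤-trans (x≤∣x∣ x) (≤-reflexive ∣x∣≡0))
    (subst₂ _≤_ -0#≈0# (-‿involutive x) (neg-antimono-≤ (≤-trans (-x≤∣x∣ x) (≤-reflexive ∣x∣≡0))))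

  ∣-x∣≤∣x∣ : ∀ x → ∣ - x ∣ ≤ ∣ x ∣
  ∣-x∣≤∣x∣ x = ∣x∣≤c (-x≤∣x∣ x) (subst (_≤ ∣ x ∣) (sym (-‿involutive x)) (x≤∣x∣ x))

  ∣-x∣≡∣x∣ : ∀ x → ∣ - x ∣ ≡ ∣ x ∣
  ∣-x∣≡∣x∣ x =
    ≤-antisym (∣-x∣≤∣x∣ x) (subst (λ y → ∣ y ∣ ≤ ∣ - x ∣) (-‿involutive x) (∣-x∣≤∣x∣ (- x)))

  ∣ax∣≡a∣x∣ : ∀ {a} x → 0# ≤ a → ∣ a * x ∣ ≡ a * ∣ x ∣
  ∣ax∣≡a∣x∣ {a} x 0≤a = ≤-antisym
    (∣x∣≤c (*-monoˡ-≤-nonNeg 0≤a (x≤∣x∣ x))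
           (subst (_≤ a * ∣ x ∣) (sym (-‿distribʳ-* a x)) (*-monoˡ-≤-nonNeg 0≤a (-x≤∣x∣ x))))
    lower
    where
    lower : a * ∣ x ∣ ≤ ∣ a * x ∣
    lower with ∣x∣-cases x
    ... | inj₁ (_ , eq) =
      subst (_≤ ∣ a * x ∣) (trans (-‿distribʳ-* a x) (cong (a *_) (sym eq))) (-x≤∣x∣ (a * x))
    ... | inj₂ (_ , eq) = subst (_≤ ∣ a * x ∣) (cong (a *_) (sym eq)) (x≤∣x∣ (a * x))

  ∣xy∣≡∣x∣∣y∣ : ∀ x y → ∣ x * y ∣ ≡ ∣ x ∣ * ∣ y ∣
  ∣xy∣≡∣x∣∣y∣ x y with ∣x∣-cases x
  ... | inj₂ (0≤x , eq) = trans (∣ax∣≡a∣x∣ y 0≤x) (cong (_* ∣ y ∣) (sym eq))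
  ... | inj₁ (x≤0 , eq) = begin-equality
    ∣ x * y ∣          ≡⟨ ∣-x∣≡∣x∣ (x * y) ⟨
    ∣ - (x * y) ∣      ≡⟨ cong ∣_∣ (-‿distribˡ-* x y) ⟩
    ∣ - x * y ∣        ≡⟨ ∣ax∣≡a∣x∣ y (x≤0⇒0≤-x x≤0) ⟩
    - x * ∣ y ∣        ≡⟨ cong (_* ∣ y ∣) eq ⟨
    ∣ x ∣ * ∣ y ∣      ∎

  ∣±1∣≡1 : ∀ {x} → x ≡ 1# ⊎ x ≡ - 1# → ∣ x ∣ ≡ 1#
  ∣±1∣≡1 (inj₁ refl) = ∣x∣≡x 0≤1
  ∣±1∣≡1 (inj₂ refl) = trans (∣-x∣≡∣x∣ 1#) (∣x∣≡x 0≤1)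

  ±1≢0 : ∀ {x} → x ≡ 1# ⊎ x ≡ - 1# → x ≢ 0#
  ±1≢0 (inj₁ refl) 1≡0 = 0≢1 (sym 1≡0)
  ±1≢0 (inj₂ refl) = -1≢0

  _⊔_ : Carrier → Carrier → Carrier
  _⊔_ = _⊔ℝ_ ℝ

  x≤x⊔y : ∀ x y → x ≤ x ⊔ y
  x≤x⊔y x y with x ≤? y
  ... | yes x≤y = x≤y
  ... | no _ = ≤-refl

  y≤x⊔y : ∀ x y → y ≤ x ⊔ y
  y≤x⊔y x y with x ≤? y
  ... | yes _ = ≤-refl
  ... | no x≰y = ≰⇒≥ x≰y

  ⊔-sel : ∀ x y → x ⊔ y ≡ x ⊎ x ⊔ y ≡ y
  ⊔-sel x y with x ≤? y
  ... | yes _ = inj₂ refl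
  ... | no _ = inj₁ refl

  ∑ : {X : Set} → List X → (X → Carrier) → Carrier
  ∑ xs f = sumList ℝ (map f xs)

  module _ {X : Set} where

    ∑-cong : ∀ (xs : List X) {f g} → f ≗ g → ∑ xs f ≡ ∑ xs g
    ∑-cong [] f≗g = refl
    ∑-cong (x ∷ xs) f≗g = cong₂ _+_ (f≗g x) (∑-cong xs f≗g)

    ∑-zero : ∀ (xs : List X) {f} → (∀ x → f x ≡ 0#) → ∑ xs f ≡ 0#
    ∑-zero [] f≗0 = refl
    ∑-zero (x ∷ xs) f≗0 = trans (cong₂ _+_ (f≗0 x) (∑-zero xs f≗0)) (+-identityʳ 0#)

    ∑-+ : ∀ (xs : List X) f g → ∑ xs (λ x → f x + g x) ≡ ∑ xs f + ∑ xs g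
    ∑-+ [] f g = sym (+-identityʳ 0#)
    ∑-+ (x ∷ xs) f g = trans (cong (f x + g x +_) (∑-+ xs f g)) (+-interchange (f x) (g x) _ _)

    ∑-*ˡ : ∀ (xs : List X) a f → ∑ xs (λ x → a * f x) ≡ a * ∑ xs f
    ∑-*ˡ [] a f = sym (zeroʳ a)
    ∑-*ˡ (x ∷ xs) a f = trans (cong (a * f x +_) (∑-*ˡ xs a f)) (sym (distribˡ a (f x) _))

    ∑-*ʳ : ∀ (xs : List X) a f → ∑ xs (λ x → f x * a) ≡ ∑ xs f * a
    ∑-*ʳ xs a f = trans (∑-cong xs (λ x → *-comm (f x) a)) (trans (∑-*ˡ xs a f) (*-comm a _))

    ∑-mono-≤ : ∀ (xs : List X) {f g} → (∀ x → f x ≤ g x) → ∑ xs f ≤ ∑ xs g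
    ∑-mono-≤ [] f≤g = ≤-refl
    ∑-mono-≤ (x ∷ xs) f≤g = +-mono-≤ (f≤g x) (∑-mono-≤ xs f≤g)

    ∑-nonNeg : ∀ (xs : List X) {f} → (∀ x → 0# ≤ f x) → 0# ≤ ∑ xs f
    ∑-nonNeg xs {f} 0≤f =
      subst (_≤ ∑ xs f) (∑-zero xs {λ _ → 0#} (λ _ → refl)) (∑-mono-≤ xs 0≤f)

    ∣∑∣≤∑∣∣ : ∀ (xs : List X) f → ∣ ∑ xs f ∣ ≤ ∑ xs (λ x → ∣ f x ∣)
    ∣∑∣≤∑∣∣ [] f = ≤-reflexive ∣0∣≡0
    ∣∑∣≤∑∣∣ (x ∷ xs) f =
      ≤-trans (∣x+y∣≤∣x∣+∣y∣ (f x) _) (+-monoʳ-≤ ∣ f x ∣ (∣∑∣≤∑∣∣ xs f))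

    ∈⇒≤∑ : ∀ {xs : List X} {f x} → (∀ y → 0# ≤ f y) → x ∈ xs → f x ≤ ∑ xs f
    ∈⇒≤∑ {y ∷ xs} {f} 0≤f (here refl) =
      subst (_≤ f y + ∑ xs f) (+-identityʳ (f y)) (+-monoʳ-≤ (f y) (∑-nonNeg xs 0≤f))
    ∈⇒≤∑ {y ∷ xs} {f} 0≤f (there x∈xs) =
      ≤-trans (∈⇒≤∑ 0≤f x∈xs)
              (subst (_≤ f y + ∑ xs f) (+-identityˡ _) (+-monoˡ-≤ (∑ xs f) (0≤f y)))

    ∑-filter : ∀ {p} {P : Pred X p} (P? : Decidable P) (xs : List X) f →
               (∀ x → ¬ P x → f x ≡ 0#) → ∑ (filter P? xs) f ≡ ∑ xs f
    ∑-filter P? [] f _ = refl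
    ∑-filter P? (x ∷ xs) f f≡0 with P? x
    ... | yes _ = cong (f x +_) (∑-filter P? xs f f≡0)
    ... | no ¬Px =
      trans (∑-filter P? xs f f≡0) (sym (trans (cong (_+ ∑ xs f) (f≡0 x ¬Px)) (+-identityˡ _)))

    fromℕ-length-filter : ∀ {p} {P : Pred X p} (P? : Decidable P) (xs : List X) →
      fromℕ ℝ (length (filter P? xs)) ≡ ∑ xs (λ x → if does (P? x) then 1# else 0#)
    fromℕ-length-filter P? [] = refl
    fromℕ-length-filter P? (x ∷ xs) with does (P? x)
    ... | true = cong (1# +_) (fromℕ-length-filter P? xs)
    ... | false = trans (fromℕ-length-filter P? xs) (sym (+-identityˡ _))

  ∑-if : ∀ {X : Set} (xs : List X) (b : Bool) f →
         ∑ xs (λ x → if b then f x else 0#) ≡ (if b then ∑ xs f else 0#)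
  ∑-if xs true f = refl
  ∑-if xs false f = ∑-zero xs (λ _ → refl)

  ∑-swap : ∀ {X Y : Set} (xs : List X) (ys : List Y) (f : X → Y → Carrier) →
           ∑ xs (λ x → ∑ ys (f x)) ≡ ∑ ys (λ y → ∑ xs (λ x → f x y))
  ∑-swap [] ys f = sym (∑-zero ys (λ _ → refl))
  ∑-swap (x ∷ xs) ys f = trans (cong (∑ ys (f x) +_) (∑-swap xs ys f))
                               (sym (∑-+ ys (f x) (λ y → ∑ xs (λ x′ → f x′ y))))

  ∑-interleave : ∀ {X Y : Set} (f g : X → Y) (xs : List X) (h : Y → Carrier) →
                 ∑ (interleave f g xs) h ≡ ∑ xs (λ x → h (f x) + h (g x))
  ∑-interleave f g [] h = refl
  ∑-interleave f g (x ∷ xs) h =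
    trans (cong (λ s → h (f x) + (h (g x) + s)) (∑-interleave f g xs h))
          (sym (+-assoc (h (f x)) (h (g x)) _))

  ∑-linear : ∀ {X : Set} (xs : List X) {f g h a} →
             (∀ x → h x ≡ f x + a * g x) → ∑ xs h ≡ ∑ xs f + a * ∑ xs g
  ∑-linear xs {f} {g} {a = a} h≡f+ag =
    trans (∑-cong xs h≡f+ag) (trans (∑-+ xs f _) (cong (∑ xs f +_) (∑-*ˡ xs a g)))

  if-linear : ∀ (b : Bool) {x y z a} → z ≡ x + a * y →
              (if b then z else 0#) ≡ (if b then x else 0#) + a * (if b then y else 0#)
  if-linear true z≡x+ay = z≡x+ay
  if-linear false {a = a} _ = sym (trans (cong (0# +_) (zeroʳ a)) (+-identityʳ 0#))

  if-zero : ∀ (b : Bool) → (if b then 0# else 0#) ≡ 0#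
  if-zero true = refl
  if-zero false = refl

  δ : ∀ {n} → Subset n → Subset n → Carrier
  δ X Y = if does (X ≟ₛ Y) then 1# else 0#

  δ-cong : ∀ {n} {X Y X′ Y′ : Subset n} → X ≡ Y ⇔ X′ ≡ Y′ → δ X Y ≡ δ X′ Y′
  δ-cong {X = X} {Y} {X′} {Y′} X≡Y⇔X′≡Y′ with X ≟ₛ Y | X′ ≟ₛ Y′
  ... | yes _ | yes _ = refl
  ... | no _ | no _ = refl
  ... | yes X≡Y | no X′≢Y′ = ⊥-elim (X′≢Y′ (Equivalence.to X≡Y⇔X′≡Y′ X≡Y))
  ... | no X≢Y | yes X′≡Y′ = ⊥-elim (X≢Y (Equivalence.from X≡Y⇔X′≡Y′ X′≡Y′))

  δ-refl : ∀ {n} (X : Subset n) → δ X X ≡ 1#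
  δ-refl X with X ≟ₛ X
  ... | yes _ = refl
  ... | no X≢X = ⊥-elim (X≢X refl)

  δ-≢ : ∀ {n} {X Y : Subset n} → X ≢ Y → δ X Y ≡ 0#
  δ-≢ {X = X} {Y} X≢Y with X ≟ₛ Y
  ... | yes X≡Y = ⊥-elim (X≢Y X≡Y)
  ... | no _ = refl

  δ≢0⇒≡ : ∀ {n} {X Y : Subset n} → δ X Y ≢ 0# → X ≡ Y
  δ≢0⇒≡ {X = X} {Y} δ≢0 with X ≟ₛ Y
  ... | yes X≡Y = X≡Y
  ... | no _ = ⊥-elim (δ≢0 refl)

  ∑-*δ : ∀ {n} (X : Subset n) (f : Subset n → Carrier) →
         ∑ (allSubsets n) (λ S → f S * δ X S) ≡ f X
  ∑-*δ [] f = trans (+-identityʳ _) (*-identityʳ _)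
  ∑-*δ {suc n} (outside ∷ X) f = begin-equality
    ∑ (allSubsets (suc n)) (λ S → f S * δ (outside ∷ X) S)
      ≡⟨ ∑-interleave (outside ∷_) (inside ∷_) (allSubsets n) _ ⟩
    ∑ (allSubsets n) (λ S → f (outside ∷ S) * δ X S + f (inside ∷ S) * 0#)
      ≡⟨ ∑-cong (allSubsets n) (λ S →
           trans (cong (f (outside ∷ S) * δ X S +_) (zeroʳ _)) (+-identityʳ _)) ⟩
    ∑ (allSubsets n) (λ S → f (outside ∷ S) * δ X S)
      ≡⟨ ∑-*δ X (f ∘ (outside ∷_)) ⟩
    f (outside ∷ X) ∎
  ∑-*δ {suc n} (inside ∷ X) f = begin-equality
    ∑ (allSubsets (suc n)) (λ S → f S * δ (inside ∷ X) S)
      ≡⟨ ∑-interleave (outside ∷_) (inside ∷_) (allSubsets n) _ ⟩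
    ∑ (allSubsets n) (λ S → f (outside ∷ S) * 0# + f (inside ∷ S) * δ X S)
      ≡⟨ ∑-cong (allSubsets n) (λ S →
           trans (cong (_+ f (inside ∷ S) * δ X S) (zeroʳ _)) (+-identityˡ _)) ⟩
    ∑ (allSubsets n) (λ S → f (inside ∷ S) * δ X S)
      ≡⟨ ∑-*δ X (f ∘ (inside ∷_)) ⟩
    f (inside ∷ X) ∎

  ∑-Δ : ∀ {n} (X : Subset n) (f : Subset n → Carrier) →
        ∑ (allSubsets n) (λ M → f (M Δ X)) ≡ ∑ (allSubsets n) f
  ∑-Δ [] f = refl
  ∑-Δ {suc n} (x ∷ X) f = begin-equality
    ∑ (allSubsets (suc n)) (λ M → f (M Δ (x ∷ X)))
      ≡⟨ ∑-interleave (outside ∷_) (inside ∷_) (allSubsets n) _ ⟩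
    ∑ (allSubsets n) (λ M → f ((outside ∷ M) Δ (x ∷ X)) + f ((inside ∷ M) Δ (x ∷ X)))
      ≡⟨ ∑-cong (allSubsets n) (pair x) ⟩
    ∑ (allSubsets n) (λ M → g (M Δ X))
      ≡⟨ ∑-Δ X g ⟩
    ∑ (allSubsets n) g
      ≡⟨ ∑-interleave (outside ∷_) (inside ∷_) (allSubsets n) f ⟨
    ∑ (allSubsets (suc n)) f ∎
    where
    g : Subset n → Carrier
    g M = f (outside ∷ M) + f (inside ∷ M)
    pair : ∀ x M → f ((outside ∷ M) Δ (x ∷ X)) + f ((inside ∷ M) Δ (x ∷ X)) ≡ g (M Δ X)
    pair outside M = refl
    pair inside M = +-comm _ _

  isNonzeroB-≢0 : ∀ {n} (φ : Poly ℝ n) S → φ S ≢ 0# → isNonzeroB ℝ φ ≡ true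
  isNonzeroB-≢0 {n} φ S φS≢0 =
    Equivalence.to T-≡ (any⁺ _ (Any.map (λ { refl → nonzero }) (∈-allSubsets S)))
    where
    nonzero : T (not ⌊ φ S ≟ 0# ⌋)
    nonzero with φ S ≟ 0#
    ... | yes φS≡0 = φS≢0 φS≡0
    ... | no _ = _

  isNonzeroB-≡0 : ∀ {n} (φ : Poly ℝ n) → IsZeroPoly ℝ φ → isNonzeroB ℝ φ ≡ false
  isNonzeroB-≡0 {n} φ φ≡0 = none (allSubsets n)
    where
    none : ∀ Ss → any (λ S → not ⌊ φ S ≟ 0# ⌋) Ss ≡ false
    none [] = refl
    none (S ∷ Ss) with φ S ≟ 0#
    ... | yes _ = none Ss
    ... | no φS≢0 = ⊥-elim (φS≢0 (φ≡0 S))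

  -- The ℓ¹ norm of multilinear polynomials

  infixl 6 _⊕_
  infixr 7 _⊙_

  _⊕_ : ∀ {n} → Poly ℝ n → Poly ℝ n → Poly ℝ n
  (φ ⊕ ψ) S = φ S + ψ S

  _⊙_ : ∀ {n} → Carrier → Poly ℝ n → Poly ℝ n
  (a ⊙ φ) S = a * φ S

  ‖_‖₁ : ∀ {n} → Poly ℝ n → Carrier
  ‖_‖₁ = ‖_‖ ℝ

  module _ {n : ℕ} where

    ‖‖₁-cong : ∀ {φ ψ : Poly ℝ n} → φ ≗ ψ → ‖ φ ‖₁ ≡ ‖ ψ ‖₁
    ‖‖₁-cong φ≗ψ = ∑-cong (allSubsets n) (cong ∣_∣ ∘ φ≗ψ)

    ∣φS∣≤‖φ‖₁ : ∀ (φ : Poly ℝ n) S → ∣ φ S ∣ ≤ ‖ φ ‖₁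
    ∣φS∣≤‖φ‖₁ φ S = ∈⇒≤∑ (0≤∣x∣ ∘ φ) (∈-allSubsets S)

    ‖φ⊕ψ‖₁≤‖φ‖₁+‖ψ‖₁ : ∀ (φ ψ : Poly ℝ n) → ‖ φ ⊕ ψ ‖₁ ≤ ‖ φ ‖₁ + ‖ ψ ‖₁
    ‖φ⊕ψ‖₁≤‖φ‖₁+‖ψ‖₁ φ ψ =
      ≤-trans (∑-mono-≤ (allSubsets n) (λ S → ∣x+y∣≤∣x∣+∣y∣ (φ S) (ψ S)))
              (≤-reflexive (∑-+ (allSubsets n) _ _))

    ‖a⊙φ‖₁≡∣a∣‖φ‖₁ : ∀ a (φ : Poly ℝ n) → ‖ a ⊙ φ ‖₁ ≡ ∣ a ∣ * ‖ φ ‖₁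
    ‖a⊙φ‖₁≡∣a∣‖φ‖₁ a φ =
      trans (∑-cong (allSubsets n) (λ S → ∣xy∣≡∣x∣∣y∣ a (φ S))) (∑-*ˡ (allSubsets n) ∣ a ∣ _)

    ‖X⊕0⊙Y‖₁≡‖X‖₁ : ∀ (X Y : Poly ℝ n) → ‖ X ⊕ 0# ⊙ Y ‖₁ ≡ ‖ X ‖₁
    ‖X⊕0⊙Y‖₁≡‖X‖₁ X Y =
      ‖‖₁-cong (λ S → trans (cong (X S +_) (zeroˡ (Y S))) (+-identityʳ (X S)))

    ‖X⊕tZ‖₁≤ : ∀ {t} (X Z : Poly ℝ n) → 0# ≤ t → t ≤ 1# →
               ‖ X ⊕ t ⊙ Z ‖₁ ≤ ‖ X ‖₁ + t * (‖ X ⊕ Z ‖₁ + - ‖ X ‖₁)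
    ‖X⊕tZ‖₁≤ {t} X Z 0≤t t≤1 = begin
      ‖ X ⊕ t ⊙ Z ‖₁
        ≡⟨ ‖‖₁-cong (λ S → convex-split (X S) (Z S)) ⟩
      ‖ (1# + - t) ⊙ X ⊕ t ⊙ (X ⊕ Z) ‖₁
        ≤⟨ ‖φ⊕ψ‖₁≤‖φ‖₁+‖ψ‖₁ _ _ ⟩
      ‖ (1# + - t) ⊙ X ‖₁ + ‖ t ⊙ (X ⊕ Z) ‖₁
        ≡⟨ cong₂ _+_ (‖a⊙φ‖₁≡∣a∣‖φ‖₁ _ X) (‖a⊙φ‖₁≡∣a∣‖φ‖₁ t _) ⟩
      ∣ 1# + - t ∣ * ‖ X ‖₁ + ∣ t ∣ * ‖ X ⊕ Z ‖₁
        ≡⟨ cong₂ (λ u v → u * ‖ X ‖₁ + v * ‖ X ⊕ Z ‖₁) (∣x∣≡x (x≤y⇒0≤y-x t≤1)) (∣x∣≡x 0≤t) ⟩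
      (1# + - t) * ‖ X ‖₁ + t * ‖ X ⊕ Z ‖₁
        ≡⟨ [1-t]x+ty≡x+t[y-x] t ‖ X ‖₁ ‖ X ⊕ Z ‖₁ ⟩
      ‖ X ‖₁ + t * (‖ X ⊕ Z ‖₁ + - ‖ X ‖₁) ∎
      where
      convex-split : ∀ x z → x + t * z ≡ (1# + - t) * x + t * (x + z)
      convex-split x z = sym (begin-equality
        (1# + - t) * x + t * (x + z)  ≡⟨ [1-t]x+ty≡x+t[y-x] t x (x + z) ⟩
        x + t * (x + z + - x)         ≡⟨ cong (λ u → x + t * (u + - x)) (+-comm x z) ⟩
        x + t * (z + x + - x)         ≡⟨ cong (λ u → x + t * u) (+-assoc z x (- x)) ⟩
        x + t * (z + (x + - x))       ≡⟨ cong (λ u → x + t * (z + u)) (-‿inverseʳ x) ⟩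
        x + t * (z + 0#)              ≡⟨ cong (λ u → x + t * u) (+-identityʳ z) ⟩
        x + t * z                     ∎)

    ‖X‖₁+‖X‖₁≤ : ∀ (X Y : Poly ℝ n) → ‖ X ‖₁ + ‖ X ‖₁ ≤ ‖ X ⊕ Y ‖₁ + ‖ X ⊕ - 1# ⊙ Y ‖₁
    ‖X‖₁+‖X‖₁≤ X Y = begin
      ‖ X ‖₁ + ‖ X ‖₁                  ≡⟨ 1+1*x≡x+x ‖ X ‖₁ ⟨
      (1# + 1#) * ‖ X ‖₁                ≡⟨ cong (_* ‖ X ‖₁) (∣x∣≡x 0≤1+1) ⟨
      ∣ 1# + 1# ∣ * ‖ X ‖₁              ≡⟨ ‖a⊙φ‖₁≡∣a∣‖φ‖₁ (1# + 1#) X ⟨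
      ‖ (1# + 1#) ⊙ X ‖₁                ≡⟨ ‖‖₁-cong (λ S → midpoint (X S) (Y S)) ⟩
      ‖ (X ⊕ Y) ⊕ (X ⊕ - 1# ⊙ Y) ‖₁     ≤⟨ ‖φ⊕ψ‖₁≤‖φ‖₁+‖ψ‖₁ _ _ ⟩
      ‖ X ⊕ Y ‖₁ + ‖ X ⊕ - 1# ⊙ Y ‖₁    ∎
      where
      midpoint : ∀ x y → (1# + 1#) * x ≡ (x + y) + (x + - 1# * y)
      midpoint x y = begin-equality
        (1# + 1#) * x             ≡⟨ 1+1*x≡x+x x ⟩
        x + x                     ≡⟨ +-identityʳ (x + x) ⟨
        (x + x) + 0#              ≡⟨ cong (x + x +_) (-‿inverseʳ y) ⟨
        (x + x) + (y + - y)       ≡⟨ +-interchange x x y (- y) ⟩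
        (x + y) + (x + - y)       ≡⟨ cong (λ u → x + y + (x + u)) (-1*x≈-x y) ⟨
        (x + y) + (x + - 1# * y)  ∎

  -- Rounding rows to signed unit vectors

  IsSign : Carrier → Set
  IsSign σ = σ ≡ 1# ⊎ σ ≡ - 1#

  module _ {m : ℕ} (X Y : Poly ℝ m) where

    best : Carrier
    best = ‖ X ⊕ Y ‖₁ ⊔ ‖ X ⊕ - 1# ⊙ Y ‖₁

    gain : Carrier
    gain = best + - ‖ X ‖₁

    0≤gain : 0# ≤ gain
    0≤gain = 0≤x+x⇒0≤x (subst (0# ≤_) regroup (x≤y⇒0≤y-x (begin
      ‖ X ‖₁ + ‖ X ‖₁                  ≤⟨ ‖X‖₁+‖X‖₁≤ X Y ⟩
      ‖ X ⊕ Y ‖₁ + ‖ X ⊕ - 1# ⊙ Y ‖₁    ≤⟨ +-mono-≤ (x≤x⊔y _ _) (y≤x⊔y _ _) ⟩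
      best + best                      ∎)))
      where
      regroup : best + best + - (‖ X ‖₁ + ‖ X ‖₁) ≡ gain + gain
      regroup = trans (cong (best + best +_) (sym (-‿+-comm ‖ X ‖₁ ‖ X ‖₁)))
                      (+-interchange best best (- ‖ X ‖₁) (- ‖ X ‖₁))

    convex-bound-mono : ∀ {t D} → 0# ≤ t → D ≤ best →
                        ‖ X ‖₁ + t * (D + - ‖ X ‖₁) ≤ ‖ X ‖₁ + t * gain
    convex-bound-mono 0≤t D≤best =
      +-monoʳ-≤ ‖ X ‖₁ (*-monoˡ-≤-nonNeg 0≤t (+-monoˡ-≤ (- ‖ X ‖₁) D≤best))

    ‖X⊕aY‖₁≤ : ∀ {a} → ∣ a ∣ ≤ 1# → ‖ X ⊕ a ⊙ Y ‖₁ ≤ ‖ X ‖₁ + ∣ a ∣ * gain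
    ‖X⊕aY‖₁≤ {a} ∣a∣≤1 with ∣x∣-cases a
    ... | inj₂ (0≤a , ∣a∣≡a) = begin
      ‖ X ⊕ a ⊙ Y ‖₁
        ≤⟨ ‖X⊕tZ‖₁≤ X Y 0≤a (subst (_≤ 1#) ∣a∣≡a ∣a∣≤1) ⟩
      ‖ X ‖₁ + a * (‖ X ⊕ Y ‖₁ + - ‖ X ‖₁)
        ≤⟨ convex-bound-mono 0≤a (x≤x⊔y _ _) ⟩
      ‖ X ‖₁ + a * gain
        ≡⟨ cong (λ u → ‖ X ‖₁ + u * gain) ∣a∣≡a ⟨
      ‖ X ‖₁ + ∣ a ∣ * gain ∎
    ... | inj₁ (a≤0 , ∣a∣≡-a) = begin
      ‖ X ⊕ a ⊙ Y ‖₁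
        ≡⟨ ‖‖₁-cong (λ S → cong (X S +_) (flip-sign (Y S))) ⟩
      ‖ X ⊕ - a ⊙ (- 1# ⊙ Y) ‖₁
        ≤⟨ ‖X⊕tZ‖₁≤ X (- 1# ⊙ Y) (x≤0⇒0≤-x a≤0) (subst (_≤ 1#) ∣a∣≡-a ∣a∣≤1) ⟩
      ‖ X ‖₁ + - a * (‖ X ⊕ - 1# ⊙ Y ‖₁ + - ‖ X ‖₁)
        ≤⟨ convex-bound-mono (x≤0⇒0≤-x a≤0) (y≤x⊔y _ _) ⟩
      ‖ X ‖₁ + - a * gain
        ≡⟨ cong (λ u → ‖ X ‖₁ + u * gain) ∣a∣≡-a ⟨
      ‖ X ‖₁ + ∣ a ∣ * gain ∎
      where
      flip-sign : ∀ y → a * y ≡ - a * (- 1# * y)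
      flip-sign y = sym (begin-equality
        - a * (- 1# * y)  ≡⟨ cong (- a *_) (-1*x≈-x y) ⟩
        - a * - y         ≡⟨ -‿distribʳ-* (- a) y ⟨
        - (- a * y)       ≡⟨ cong -_ (-‿distribˡ-* a y) ⟨
        - - (a * y)       ≡⟨ -‿involutive (a * y) ⟩
        a * y             ∎)

    gain-attained : Σ Carrier λ σ → IsSign σ × ‖ X ⊕ σ ⊙ Y ‖₁ ≡ ‖ X ‖₁ + gain
    gain-attained with ⊔-sel ‖ X ⊕ Y ‖₁ ‖ X ⊕ - 1# ⊙ Y ‖₁
    ... | inj₁ best≡+ =
      1# , inj₁ refl , trans (‖‖₁-cong (λ S → cong (X S +_) (*-identityˡ (Y S))))
                             (trans (sym best≡+) (sym (x+[y-x]≡y ‖ X ‖₁ best)))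
    ... | inj₂ best≡- = - 1# , inj₂ refl , trans (sym best≡-) (sym (x+[y-x]≡y ‖ X ‖₁ best))

  argmax-on-support : ∀ {X : Set} (t g : X → Carrier) (xs : List X) →
    (∀ x → x ∈ xs → t x ≡ 0#) ⊎
    Σ X λ x* → t x* ≢ 0# × (∀ x → x ∈ xs → t x ≢ 0# → g x ≤ g x*)
  argmax-on-support t g [] = inj₁ (λ _ ())
  argmax-on-support t g (y ∷ xs) with argmax-on-support t g xs | t y ≟ 0#
  ... | inj₁ t≡0 | yes ty≡0 =
    inj₁ λ { x (here refl) → ty≡0 ; x (there x∈xs) → t≡0 x x∈xs }
  ... | inj₁ t≡0 | no ty≢0 =
    inj₂ (y , ty≢0 , λ { x (here refl) _ → ≤-refl
                       ; x (there x∈xs) tx≢0 → ⊥-elim (tx≢0 (t≡0 x x∈xs)) })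
  ... | inj₂ (x* , tx*≢0 , max) | yes ty≡0 =
    inj₂ (x* , tx*≢0 , λ { x (here refl) tx≢0 → ⊥-elim (tx≢0 ty≡0)
                         ; x (there x∈xs) → max x x∈xs })
  ... | inj₂ (x* , tx*≢0 , max) | no ty≢0 with g y ≤? g x*
  ...   | yes gy≤gx* =
    inj₂ (x* , tx*≢0 , λ { x (here refl) _ → gy≤gx* ; x (there x∈xs) → max x x∈xs })
  ...   | no gy≰gx* =
    inj₂ (y , ty≢0 , λ { x (here refl) _ → ≤-refl
                       ; x (there x∈xs) tx≢0 → ≤-trans (max x x∈xs tx≢0) (≰⇒≥ gy≰gx*) })

  RoundsTo : ∀ {n} → Poly ℝ n → Poly ℝ n → Set
  RoundsTo {n} a r = (IsZeroPoly ℝ a × IsZeroPoly ℝ r)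
                   ⊎ Σ (Subset n) λ S* → Σ Carrier λ σ → a S* ≢ 0# × IsSign σ × r ≗ σ ⊙ δ S*

  module _ {n m : ℕ} (X : Subset n → Poly ℝ m) (Y : Poly ℝ m) where

    -- Each summand is at most ‖X S‖₁ + ∣a S∣·gain (convexity in a S); as ∑∣a S∣ ≤ 1, the total
    -- gain is at most the largest gain on the support of a, which a signed unit vector attains.
    ∑‖X⊕aY‖₁≤∑‖X⊕rY‖₁ : ∀ (a : Poly ℝ n) → ‖ a ‖₁ ≤ 1# →
      Σ (Poly ℝ n) λ r → RoundsTo a r ×
        ∑ (allSubsets n) (λ S → ‖ X S ⊕ a S ⊙ Y ‖₁) ≤ ∑ (allSubsets n) (λ S → ‖ X S ⊕ r S ⊙ Y ‖₁)
    ∑‖X⊕aY‖₁≤∑‖X⊕rY‖₁ a ‖a‖≤1 with argmax-on-support a (λ S → gain (X S) Y) (allSubsets n)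
    ... | inj₁ a≡0 = a , inj₁ (a≡0′ , a≡0′) , ≤-refl
      where
      a≡0′ : IsZeroPoly ℝ a
      a≡0′ S = a≡0 S (∈-allSubsets S)
    ... | inj₂ (S* , aS*≢0 , maximal) =
      σ ⊙ δ S* , inj₂ (S* , σ , aS*≢0 , σ-sign , λ _ → refl) , (begin
        ∑ Ss (λ S → ‖ X S ⊕ a S ⊙ Y ‖₁)
          ≤⟨ ∑-mono-≤ Ss (λ S → ‖X⊕aY‖₁≤ (X S) Y (≤-trans (∣φS∣≤‖φ‖₁ a S) ‖a‖≤1)) ⟩
        ∑ Ss (λ S → ‖ X S ‖₁ + ∣ a S ∣ * gain (X S) Y)
          ≡⟨ ∑-+ Ss _ _ ⟩
        ∑ Ss (λ S → ‖ X S ‖₁) + ∑ Ss (λ S → ∣ a S ∣ * gain (X S) Y)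
          ≤⟨ +-monoʳ-≤ _ weighted-gain≤gain* ⟩
        ∑ Ss (λ S → ‖ X S ‖₁) + gain*
          ≡⟨ cong (_ +_) (∑-*δ S* (λ _ → gain*)) ⟨
        ∑ Ss (λ S → ‖ X S ‖₁) + ∑ Ss (λ S → gain* * δ S* S)
          ≡⟨ ∑-+ Ss _ _ ⟨
        ∑ Ss (λ S → ‖ X S ‖₁ + gain* * δ S* S)
          ≡⟨ ∑-cong Ss at-vertex ⟨
        ∑ Ss (λ S → ‖ X S ⊕ (σ ⊙ δ S*) S ⊙ Y ‖₁) ∎)
      where
      Ss : List (Subset n)
      Ss = allSubsets n
      gain* : Carrier
      gain* = gain (X S*) Y
      σ : Carrier
      σ = proj₁ (gain-attained (X S*) Y)
      σ-sign : IsSign σ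
      σ-sign = proj₁ (proj₂ (gain-attained (X S*) Y))

      weighted-gain≤gain* : ∑ Ss (λ S → ∣ a S ∣ * gain (X S) Y) ≤ gain*
      weighted-gain≤gain* = begin
        ∑ Ss (λ S → ∣ a S ∣ * gain (X S) Y)  ≤⟨ ∑-mono-≤ Ss termwise ⟩
        ∑ Ss (λ S → ∣ a S ∣ * gain*)         ≡⟨ ∑-*ʳ Ss gain* _ ⟩
        ‖ a ‖₁ * gain*                       ≤⟨ *-monoʳ-≤-nonNeg (0≤gain (X S*) Y) ‖a‖≤1 ⟩
        1# * gain*                           ≡⟨ *-identityˡ gain* ⟩
        gain*                                ∎
        where
        termwise : ∀ S → ∣ a S ∣ * gain (X S) Y ≤ ∣ a S ∣ * gain*
        termwise S with a S ≟ 0#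
        ... | no aS≢0 = *-monoˡ-≤-nonNeg (0≤∣x∣ (a S)) (maximal S (∈-allSubsets S) aS≢0)
        ... | yes aS≡0 = ≤-reflexive (trans (∣aS∣*g≡0 _) (sym (∣aS∣*g≡0 gain*)))
          where
          ∣aS∣*g≡0 : ∀ g → ∣ a S ∣ * g ≡ 0#
          ∣aS∣*g≡0 g = trans (cong (λ u → ∣ u ∣ * g) aS≡0) (trans (cong (_* g) ∣0∣≡0) (zeroˡ g))

      at-vertex : ∀ S → ‖ X S ⊕ (σ ⊙ δ S*) S ⊙ Y ‖₁ ≡ ‖ X S ‖₁ + gain* * δ S* S
      at-vertex S with S* ≟ₛ S
      ... | yes refl = begin-equality
        ‖ X S* ⊕ (σ * 1#) ⊙ Y ‖₁   ≡⟨ cong (λ u → ‖ X S* ⊕ u ⊙ Y ‖₁) (*-identityʳ σ) ⟩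
        ‖ X S* ⊕ σ ⊙ Y ‖₁          ≡⟨ proj₂ (proj₂ (gain-attained (X S*) Y)) ⟩
        ‖ X S* ‖₁ + gain*          ≡⟨ cong (‖ X S* ‖₁ +_) (*-identityʳ gain*) ⟨
        ‖ X S* ‖₁ + gain* * 1#     ∎
      ... | no _ = begin-equality
        ‖ X S ⊕ (σ * 0#) ⊙ Y ‖₁    ≡⟨ cong (λ u → ‖ X S ⊕ u ⊙ Y ‖₁) (zeroʳ σ) ⟩
        ‖ X S ⊕ 0# ⊙ Y ‖₁          ≡⟨ ‖X⊕0⊙Y‖₁≡‖X‖₁ (X S) Y ⟩
        ‖ X S ‖₁                   ≡⟨ +-identityʳ _ ⟨
        ‖ X S ‖₁ + 0#              ≡⟨ cong (‖ X S ‖₁ +_) (zeroʳ gain*) ⟨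
        ‖ X S ‖₁ + gain* * 0#      ∎

  module _ {n : ℕ} where

    c⊙δ≢0⇒≡ : ∀ {c} {X S : Subset n} → (c ⊙ δ X) S ≢ 0# → X ≡ S
    c⊙δ≢0⇒≡ {c} cδ≢0 = δ≢0⇒≡ (λ δ≡0 → cδ≢0 (trans (cong (c *_) δ≡0) (zeroʳ c)))

    c⊙δ-self : ∀ c (X : Subset n) → (c ⊙ δ X) X ≡ c
    c⊙δ-self c X = trans (cong (c *_) (δ-refl X)) (*-identityʳ c)

    c⊙δ-other : ∀ c {X S : Subset n} → X ≢ S → (c ⊙ δ X) S ≡ 0#
    c⊙δ-other c X≢S = trans (cong (c *_) (δ-≢ X≢S)) (zeroʳ c)

    ‖signedUnit‖₁≡1 : ∀ {σ} (S* : Subset n) → IsSign σ → ‖ σ ⊙ δ S* ‖₁ ≡ 1#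
    ‖signedUnit‖₁≡1 {σ} S* σ-sign = begin-equality
      ‖ σ ⊙ δ S* ‖₁                       ≡⟨ ‖a⊙φ‖₁≡∣a∣‖φ‖₁ σ (δ S*) ⟩
      ∣ σ ∣ * ‖ δ S* ‖₁                   ≡⟨ cong (_* ‖ δ S* ‖₁) (∣±1∣≡1 σ-sign) ⟩
      1# * ‖ δ S* ‖₁                      ≡⟨ *-identityˡ _ ⟩
      ∑ (allSubsets n) (λ S → ∣ δ S* S ∣)  ≡⟨ ∑-cong (allSubsets n) ∣δ∣≡1*δ ⟩
      ∑ (allSubsets n) (λ S → 1# * δ S* S) ≡⟨ ∑-*δ S* (λ _ → 1#) ⟩
      1#                                  ∎
      where
      ∣δ∣≡1*δ : ∀ S → ∣ δ S* S ∣ ≡ 1# * δ S* S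
      ∣δ∣≡1*δ S with S* ≟ₛ S
      ... | yes _ = trans (∣x∣≡x 0≤1) (sym (*-identityˡ 1#))
      ... | no _ = trans ∣0∣≡0 (sym (zeroʳ 1#))

    RoundsTo-support : ∀ {a r : Poly ℝ n} → RoundsTo a r → ∀ S → r S ≢ 0# → a S ≢ 0#
    RoundsTo-support (inj₁ (_ , r≡0)) S rS≢0 = ⊥-elim (rS≢0 (r≡0 S))
    RoundsTo-support (inj₂ (S* , σ , aS*≢0 , _ , r≗)) S rS≢0
      with refl ← c⊙δ≢0⇒≡ {σ} {S*} {S} (λ σδ≡0 → rS≢0 (trans (r≗ S) σδ≡0)) = aS*≢0

    RoundsTo-zero : ∀ {a r : Poly ℝ n} → RoundsTo a r → IsZeroPoly ℝ r → IsZeroPoly ℝ a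
    RoundsTo-zero (inj₁ (a≡0 , _)) _ = a≡0
    RoundsTo-zero (inj₂ (S* , σ , _ , σ-sign , r≗)) r≡0 =
      ⊥-elim (±1≢0 σ-sign (trans (sym (c⊙δ-self σ S*)) (trans (sym (r≗ S*)) (r≡0 S*))))

    RoundsTo-‖‖₁≤1 : ∀ {a r : Poly ℝ n} → RoundsTo a r → ‖ r ‖₁ ≤ 1#
    RoundsTo-‖‖₁≤1 {r = r} (inj₁ (_ , r≡0)) =
      ≤-trans (≤-reflexive (∑-zero (allSubsets n) (λ S → trans (cong ∣_∣ (r≡0 S)) ∣0∣≡0))) 0≤1
    RoundsTo-‖‖₁≤1 (inj₂ (S* , σ , _ , σ-sign , r≗)) =
      ≤-reflexive (trans (‖‖₁-cong r≗) (‖signedUnit‖₁≡1 S* σ-sign))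

    RoundsTo-trans : ∀ {a r r′ : Poly ℝ n} → RoundsTo a r → RoundsTo r r′ → RoundsTo a r′
    RoundsTo-trans a→r (inj₁ (r≡0 , r′≡0)) = inj₁ (RoundsTo-zero a→r r≡0 , r′≡0)
    RoundsTo-trans a→r (inj₂ (S* , σ , rS*≢0 , σ-sign , r′≗)) =
      inj₂ (S* , σ , RoundsTo-support a→r S* rS*≢0 , σ-sign , r′≗)

    RoundsTo-respˡ : ∀ {a a′ r : Poly ℝ n} → (∀ S → a S ≡ 0# ⇔ a′ S ≡ 0#) →
                     RoundsTo a r → RoundsTo a′ r
    RoundsTo-respˡ sameZeros (inj₁ (a≡0 , r≡0)) =
      inj₁ ((λ S → Equivalence.to (sameZeros S) (a≡0 S)) , r≡0)
    RoundsTo-respˡ sameZeros (inj₂ (S* , σ , aS*≢0 , σ-sign , r≗)) =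
      inj₂ (S* , σ , aS*≢0 ∘ Equivalence.from (sameZeros S*) , σ-sign , r≗)

    ≗⇒sameZeros : ∀ {a a′ : Poly ℝ n} → a ≗ a′ → ∀ S → a S ≡ 0# ⇔ a′ S ≡ 0#
    ≗⇒sameZeros a≗a′ S = mk⇔ (trans (sym (a≗a′ S))) (trans (a≗a′ S))

    RoundsTo-respʳ : ∀ {a r r′ : Poly ℝ n} → r ≗ r′ → RoundsTo a r → RoundsTo a r′
    RoundsTo-respʳ r≗r′ (inj₁ (a≡0 , r≡0)) = inj₁ (a≡0 , λ S → trans (sym (r≗r′ S)) (r≡0 S))
    RoundsTo-respʳ r≗r′ (inj₂ (S* , σ , aS*≢0 , σ-sign , r≗)) =
      inj₂ (S* , σ , aS*≢0 , σ-sign , λ S → trans (sym (r≗r′ S)) (r≗ S))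

    RoundsTo⁼ : Poly ℝ n → Poly ℝ n → Set
    RoundsTo⁼ a r = RoundsTo a r ⊎ r ≗ a

    RoundsTo-⁼-trans : ∀ {a r r′ : Poly ℝ n} → RoundsTo a r → RoundsTo⁼ r r′ → RoundsTo a r′
    RoundsTo-⁼-trans a→r (inj₁ r→r′) = RoundsTo-trans a→r r→r′
    RoundsTo-⁼-trans a→r (inj₂ r′≗r) = RoundsTo-respʳ (λ S → sym (r′≗r S)) a→r

    ⁼-RoundsTo-trans : ∀ {a r r′ : Poly ℝ n} → RoundsTo⁼ a r → RoundsTo r r′ → RoundsTo a r′
    ⁼-RoundsTo-trans (inj₁ a→r) r→r′ = RoundsTo-trans a→r r→r′
    ⁼-RoundsTo-trans (inj₂ r≗a) r→r′ = RoundsTo-respˡ (≗⇒sameZeros r≗a) r→r′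

    RoundsTo⁼-trans : ∀ {a r r′ : Poly ℝ n} → RoundsTo⁼ a r → RoundsTo⁼ r r′ → RoundsTo⁼ a r′
    RoundsTo⁼-trans (inj₁ a→r) r→r′ = inj₁ (RoundsTo-⁼-trans a→r r→r′)
    RoundsTo⁼-trans (inj₂ r≗a) (inj₁ r→r′) = inj₁ (RoundsTo-respˡ (≗⇒sameZeros r≗a) r→r′)
    RoundsTo⁼-trans (inj₂ r≗a) (inj₂ r′≗r) = inj₂ (λ S → trans (r′≗r S) (r≗a S))

    RoundsTo⁼-‖‖₁≤1 : ∀ {a r : Poly ℝ n} → RoundsTo⁼ a r → ‖ a ‖₁ ≤ 1# → ‖ r ‖₁ ≤ 1#
    RoundsTo⁼-‖‖₁≤1 (inj₁ a→r) _ = RoundsTo-‖‖₁≤1 a→r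
    RoundsTo⁼-‖‖₁≤1 (inj₂ r≗a) ‖a‖≤1 = subst (_≤ 1#) (‖‖₁-cong (λ S → sym (r≗a S))) ‖a‖≤1

    RoundsTo-entries : ∀ {a r : Poly ℝ n} → RoundsTo a r → ∀ S → r S ≡ 0# ⊎ IsSign (r S)
    RoundsTo-entries (inj₁ (_ , r≡0)) S = inj₁ (r≡0 S)
    RoundsTo-entries (inj₂ (S* , σ , _ , σ-sign , r≗)) S with S* ≟ₛ S
    ... | yes refl = inj₂ (subst IsSign (sym (trans (r≗ S) (c⊙δ-self σ S))) σ-sign)
    ... | no S*≢S = inj₁ (trans (r≗ S) (c⊙δ-other σ S*≢S))

  module RoundingFamilies
    {n m : ℕ} {Leaf : Set} (_≟ᴸ_ : DecidableEquality Leaf)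
    (G : (Leaf → Carrier) → Poly ℝ m)
    (G-linear : ∀ f g h a → (∀ w → h w ≡ f w + a * g w) → G h ≗ G f ⊕ a ⊙ G g)
    where

    Family : Set
    Family = Subset n → Leaf → Carrier

    row : Family → Leaf → Poly ℝ n
    row β w S = β S w

    F : Family → Carrier
    F β = ∑ (allSubsets n) (λ S → ‖ G (β S) ‖₁)

    indicator : Leaf → Leaf → Carrier
    indicator w₀ w = if does (w ≟ᴸ w₀) then 1# else 0#

    clearRow : Family → Leaf → Family
    clearRow β w₀ S w = if does (w ≟ᴸ w₀) then 0# else β S w

    -- Written as a sum so that G-linear splits off the contribution of the new row.
    withRow : Family → Leaf → Poly ℝ n → Family
    withRow β w₀ r S w = clearRow β w₀ S w + r S * indicator w₀ w

    withRow-self : ∀ β w₀ S w → β S w ≡ withRow β w₀ (row β w₀) S w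
    withRow-self β w₀ S w with w ≟ᴸ w₀
    ... | yes refl = sym (trans (+-identityˡ _) (*-identityʳ _))
    ... | no _ = sym (trans (cong (β S w +_) (zeroʳ _)) (+-identityʳ _))

    row-withRow-≡ : ∀ β w₀ r → row (withRow β w₀ r) w₀ ≗ r
    row-withRow-≡ β w₀ r S with w₀ ≟ᴸ w₀
    ... | yes _ = trans (+-identityˡ _) (*-identityʳ _)
    ... | no w₀≢w₀ = ⊥-elim (w₀≢w₀ refl)

    row-withRow-≢ : ∀ β w₀ r w → w ≢ w₀ → row (withRow β w₀ r) w ≗ row β w
    row-withRow-≢ β w₀ r w w≢w₀ S with w ≟ᴸ w₀
    ... | yes w≡w₀ = ⊥-elim (w≢w₀ w≡w₀)
    ... | no _ = trans (cong (β S w +_) (zeroʳ _)) (+-identityʳ _)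

    F-withRow : ∀ β w₀ r → F (withRow β w₀ r) ≡
      ∑ (allSubsets n) (λ S → ‖ G (clearRow β w₀ S) ⊕ r S ⊙ G (indicator w₀) ‖₁)
    F-withRow β w₀ r =
      ∑-cong (allSubsets n) (λ S → ‖‖₁-cong (G-linear _ _ _ (r S) (λ _ → refl)))

    F-row : ∀ β w₀ → F β ≡
      ∑ (allSubsets n) (λ S → ‖ G (clearRow β w₀ S) ⊕ β S w₀ ⊙ G (indicator w₀) ‖₁)
    F-row β w₀ =
      ∑-cong (allSubsets n) (λ S → ‖‖₁-cong (G-linear _ _ _ (β S w₀) (withRow-self β w₀ S)))

    round-row : ∀ β w₀ → ‖ row β w₀ ‖₁ ≤ 1# →
      Σ Family λ β′ → F β ≤ F β′ × RoundsTo (row β w₀) (row β′ w₀)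
                                × (∀ w → RoundsTo⁼ (row β w) (row β′ w))
    round-row β w₀ ‖row‖≤1
      with ∑‖X⊕aY‖₁≤∑‖X⊕rY‖₁ (G ∘ clearRow β w₀) (G (indicator w₀)) (row β w₀) ‖row‖≤1
    ... | r , rounds , F≤ =
      withRow β w₀ r , subst₂ _≤_ (sym (F-row β w₀)) (sym (F-withRow β w₀ r)) F≤ , rounds₀ , rounds⁼
      where
      rounds₀ : RoundsTo (row β w₀) (row (withRow β w₀ r) w₀)
      rounds₀ = RoundsTo-respʳ (λ S → sym (row-withRow-≡ β w₀ r S)) rounds
      rounds⁼ : ∀ w → RoundsTo⁼ (row β w) (row (withRow β w₀ r) w)
      rounds⁼ w = byLeaf (w ≟ᴸ w₀)
        where
        byLeaf : Dec (w ≡ w₀) → RoundsTo⁼ (row β w) (row (withRow β w₀ r) w)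
        byLeaf (yes refl) = inj₁ rounds₀
        byLeaf (no w≢w₀) = inj₂ (row-withRow-≢ β w₀ r w w≢w₀)

    round-rows : ∀ (ws : List Leaf) β → (∀ w → ‖ row β w ‖₁ ≤ 1#) →
      Σ Family λ e → F β ≤ F e × (∀ w → RoundsTo⁼ (row β w) (row e w))
                              × (∀ w → w ∈ ws → RoundsTo (row β w) (row e w))
    round-rows [] β _ = β , ≤-refl , (λ _ → inj₂ (λ _ → refl)) , (λ _ ())
    round-rows (w₀ ∷ ws) β bounded with round-row β w₀ (bounded w₀)
    ... | β₁ , F≤F₁ , rounds₀ , step
        with round-rows ws β₁ (λ w → RoundsTo⁼-‖‖₁≤1 (step w) (bounded w))
    ... | e , F₁≤Fe , rounds⁼ , rounds =
      e , ≤-trans F≤F₁ F₁≤Fe , (λ w → RoundsTo⁼-trans (step w) (rounds⁼ w)) , rounds′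
      where
      rounds′ : ∀ w → w ∈ w₀ ∷ ws → RoundsTo (row β w) (row e w)
      rounds′ w (here refl) = RoundsTo-⁼-trans rounds₀ (rounds⁼ w₀)
      rounds′ w (there w∈ws) = ⁼-RoundsTo-trans (step w) (rounds w w∈ws)

  constPoly : ∀ {n} → Carrier → Poly ℝ n
  constPoly c = c ⊙ δ ⊥

  withConstantLeaves : ∀ {n d} → DTree ℝ n d → (Vec Sign d → Carrier) → DTree ℝ n d
  withConstantLeaves {n} T f = record
    { query = query T
    ; leaf = constPoly ∘ f
    ; distinct = distinct T
    ; avoid = λ w i S c≢0 → let j = query T i (prefix w i) in
        subst (λ X → lookup X j ≡ outside) (c⊙δ≢0⇒≡ {n} {f w} {⊥} {S} c≢0) (lookup-replicate j outside)
    }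

  module Restriction {n d} (T : DTree ℝ n d) (𝒮 : Subset d → Bool) where

    G : (Vec Sign d → Carrier) → Poly ℝ n
    G f = restrict ℝ (withConstantLeaves T f) 𝒮

    kernel : Subset n → Subset d → Vec Sign d → Carrier → Carrier
    kernel M A w c = 2^ ℝ d ⁻¹ * (signProd ℝ w A * constPoly c (M Δ pathVars ℝ T w A))

    kernel-linear : ∀ M A w x a y → kernel M A w (x + a * y) ≡ kernel M A w x + a * kernel M A w y
    kernel-linear M A w x a y = begin-equality
      i * (s * ((x + a * y) * δ ⊥ Z))
        ≡⟨ cong (λ u → i * (s * u)) (*-linearʳ x a y (δ ⊥ Z)) ⟩
      i * (s * (x * δ ⊥ Z + a * (y * δ ⊥ Z)))
        ≡⟨ cong (i *_) (*-linearˡ s _ a _) ⟩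
      i * (s * (x * δ ⊥ Z) + a * (s * (y * δ ⊥ Z)))
        ≡⟨ *-linearˡ i _ a _ ⟩
      i * (s * (x * δ ⊥ Z)) + a * (i * (s * (y * δ ⊥ Z))) ∎
      where
      i = 2^ ℝ d ⁻¹
      s = signProd ℝ w A
      Z = M Δ pathVars ℝ T w A

    G-linear : ∀ f g h a → (∀ w → h w ≡ f w + a * g w) → G h ≗ G f ⊕ a ⊙ G g
    G-linear f g h a h≡f+ag M =
      ∑-linear (allSubsets d) λ A → if-linear (𝒮 A) (∑-linear (allSigns d) λ w →
        trans (cong (kernel M A w) (h≡f+ag w)) (kernel-linear M A w (f w) a (g w)))

    G-zero : ∀ f → (∀ w → f w ≡ 0#) → IsZeroPoly ℝ (G f)
    G-zero f f≡0 M = ∑-zero (allSubsets d) λ A →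
      trans (cong (λ u → if 𝒮 A then u else 0#) (∑-zero (allSigns d) (kernel-0 A))) (if-zero (𝒮 A))
      where
      kernel-0 : ∀ A w → kernel M A w (f w) ≡ 0#
      kernel-0 A w = begin-equality
        i * (s * (f w * δ ⊥ Z))  ≡⟨ cong (λ u → i * (s * (u * δ ⊥ Z))) (f≡0 w) ⟩
        i * (s * (0# * δ ⊥ Z))   ≡⟨ cong (λ u → i * (s * u)) (zeroˡ (δ ⊥ Z)) ⟩
        i * (s * 0#)             ≡⟨ cong (i *_) (zeroʳ s) ⟩
        i * 0#                   ≡⟨ zeroʳ i ⟩
        0#                       ∎
        where
        i = 2^ ℝ d ⁻¹
        s = signProd ℝ w A
        Z = M Δ pathVars ℝ T w A

    G-scale : ∀ f h a → (∀ w → h w ≡ a * f w) → G h ≗ a ⊙ G f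
    G-scale f h a h≡af M = begin-equality
      G h M                       ≡⟨ G-linear (λ _ → 0#) f h a h≡0+af M ⟩
      G (λ _ → 0#) M + a * G f M  ≡⟨ cong (_+ a * G f M) (G-zero (λ _ → 0#) (λ _ → refl) M) ⟩
      0# + a * G f M              ≡⟨ +-identityˡ _ ⟩
      a * G f M                   ∎
      where
      h≡0+af : ∀ w → h w ≡ 0# + a * f w
      h≡0+af w = trans (h≡af w) (sym (+-identityˡ _))

    coefficient : Subset n → Vec Sign d → Carrier
    coefficient S w = leaf T w S

    -- The constant leaf c_S(w) shifted by x^S contributes to the monomial x^M through
    -- x^(S Δ P), so only S = M Δ P survives: this recovers the coefficient T(w)(M Δ P).
    restrict-decomposition : ∀ M →
      restrict ℝ T 𝒮 M ≡ ∑ (allSubsets n) (λ S → G (coefficient S) (M Δ S))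
    restrict-decomposition M = sym (begin-equality
      ∑ (allSubsets n) (λ S → G (coefficient S) (M Δ S))
        ≡⟨ ∑-swap (allSubsets n) (allSubsets d) _ ⟩
      ∑ (allSubsets d) (λ A → ∑ (allSubsets n) λ S → if 𝒮 A then ∑ (allSigns d) (term S A) else 0#)
        ≡⟨ ∑-cong (allSubsets d) (λ A → trans (∑-if (allSubsets n) (𝒮 A) _)
                                              (cong (λ u → if 𝒮 A then u else 0#) (collect A))) ⟩
      restrict ℝ T 𝒮 M ∎)
      where
      term : Subset n → Subset d → Vec Sign d → Carrier
      term S A w = kernel (M Δ S) A w (coefficient S w)

      select : ∀ w P S → constPoly (coefficient S w) ((M Δ S) Δ P) ≡ coefficient S w * δ (M Δ P) S
      select w P S = cong (coefficient S w *_) (δ-cong (mk⇔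
        (λ ⊥≡ → Equivalence.to (Δ≡⊥⇔≡ (M Δ P) S) (sym (trans ⊥≡ (Δ-rightComm M S P))))
        (λ M∆P≡S → sym (trans (Δ-rightComm M S P) (Equivalence.from (Δ≡⊥⇔≡ (M Δ P) S) M∆P≡S)))))

      collect : ∀ A → ∑ (allSubsets n) (λ S → ∑ (allSigns d) (term S A)) ≡
        ∑ (allSigns d) (λ w → 2^ ℝ d ⁻¹ * (signProd ℝ w A * leaf T w (M Δ pathVars ℝ T w A)))
      collect A = trans (∑-swap (allSubsets n) (allSigns d) _) (∑-cong (allSigns d) λ w →
        let i = 2^ ℝ d ⁻¹ ; s = signProd ℝ w A ; P = pathVars ℝ T w A in begin-equality
        ∑ (allSubsets n) (λ S → i * (s * constPoly (coefficient S w) ((M Δ S) Δ P)))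
          ≡⟨ ∑-*ˡ (allSubsets n) i _ ⟩
        i * ∑ (allSubsets n) (λ S → s * constPoly (coefficient S w) ((M Δ S) Δ P))
          ≡⟨ cong (i *_) (∑-*ˡ (allSubsets n) s _) ⟩
        i * (s * ∑ (allSubsets n) (λ S → constPoly (coefficient S w) ((M Δ S) Δ P)))
          ≡⟨ cong (λ u → i * (s * u)) (∑-cong (allSubsets n) (select w P)) ⟩
        i * (s * ∑ (allSubsets n) (λ S → coefficient S w * δ (M Δ P) S))
          ≡⟨ cong (λ u → i * (s * u)) (∑-*δ (M Δ P) (λ S → coefficient S w)) ⟩
        i * (s * leaf T w (M Δ P)) ∎)

    ‖restrict‖₁≤ : ‖ restrict ℝ T 𝒮 ‖₁ ≤ ∑ (allSubsets n) (λ S → ‖ G (coefficient S) ‖₁)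
    ‖restrict‖₁≤ = begin
      ‖ restrict ℝ T 𝒮 ‖₁
        ≡⟨ ‖‖₁-cong restrict-decomposition ⟩
      ∑ (allSubsets n) (λ M → ∣ ∑ (allSubsets n) (λ S → G (coefficient S) (M Δ S)) ∣)
        ≤⟨ ∑-mono-≤ (allSubsets n) (λ M → ∣∑∣≤∑∣∣ (allSubsets n) _) ⟩
      ∑ (allSubsets n) (λ M → ∑ (allSubsets n) (λ S → ∣ G (coefficient S) (M Δ S) ∣))
        ≡⟨ ∑-swap (allSubsets n) (allSubsets n) _ ⟩
      ∑ (allSubsets n) (λ S → ∑ (allSubsets n) (λ M → ∣ G (coefficient S) (M Δ S) ∣))
        ≡⟨ ∑-cong (allSubsets n) (λ S → ∑-Δ S (λ M → ∣ G (coefficient S) M ∣)) ⟩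
      ∑ (allSubsets n) (λ S → ‖ G (coefficient S) ‖₁) ∎

  -- Densities

  fromℕ-nonNeg : ∀ j → 0# ≤ fromℕ ℝ j
  fromℕ-nonNeg zero = ≤-refl
  fromℕ-nonNeg (suc j) =
    subst (_≤ 1# + fromℕ ℝ j) (+-identityʳ 0#) (+-mono-≤ 0≤1 (fromℕ-nonNeg j))

  fromℕ-mono-≤ : ∀ {j l} → j ℕ.≤ l → fromℕ ℝ j ≤ fromℕ ℝ l
  fromℕ-mono-≤ {zero} {l} _ = fromℕ-nonNeg l
  fromℕ-mono-≤ {suc j} {suc l} (ℕ.s≤s j≤l) = +-monoʳ-≤ 1# (fromℕ-mono-≤ j≤l)

  fromℕ-+ : ∀ j l → fromℕ ℝ (j ℕ.+ l) ≡ fromℕ ℝ j + fromℕ ℝ l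
  fromℕ-+ zero l = sym (+-identityˡ _)
  fromℕ-+ (suc j) l = trans (cong (1# +_) (fromℕ-+ j l)) (sym (+-assoc 1# _ _))

  fromℕ-length-allSigns : ∀ d → fromℕ ℝ (length (allSigns d)) ≡ 2^ ℝ d
  fromℕ-length-allSigns zero = +-identityʳ 1#
  fromℕ-length-allSigns (suc d) = begin-equality
    fromℕ ℝ (length (allSigns (suc d)))
      ≡⟨ cong (fromℕ ℝ) (length-interleave (minus ∷_) (plus ∷_) (allSigns d)) ⟩
    fromℕ ℝ (length (allSigns d) ℕ.+ length (allSigns d))
      ≡⟨ fromℕ-+ (length (allSigns d)) _ ⟩
    fromℕ ℝ (length (allSigns d)) + fromℕ ℝ (length (allSigns d))
      ≡⟨ cong₂ _+_ (fromℕ-length-allSigns d) (fromℕ-length-allSigns d) ⟩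
    2^ ℝ d + 2^ ℝ d
      ≡⟨ 1+1*x≡x+x (2^ ℝ d) ⟨
    2^ ℝ (suc d) ∎

  1≤2^ : ∀ d → 1# ≤ 2^ ℝ d
  1≤2^ zero = ≤-refl
  1≤2^ (suc d) =
    subst₂ _≤_ (+-identityʳ 1#) (sym (1+1*x≡x+x _)) (+-mono-≤ (1≤2^ d) (≤-trans 0≤1 (1≤2^ d)))

  2^≢0 : ∀ d → 2^ ℝ d ≢ 0#
  2^≢0 d 2^d≡0 = 1≰0 (subst (1# ≤_) 2^d≡0 (1≤2^ d))

  nonzeroIndicator : ∀ {n} → Poly ℝ n → Carrier
  nonzeroIndicator φ = if isNonzeroB ℝ φ then 1# else 0#

  density≡∑ : ∀ {n d} (T : DTree ℝ n d) →
    density ℝ T ≡ ∑ (allSigns d) (λ w → nonzeroIndicator (leaf T w)) * 2^ ℝ d ⁻¹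
  density≡∑ {d = d} T = cong (_* 2^ ℝ d ⁻¹)
    (trans (fromℕ-length-filter (λ w → isNonzeroB ℝ (leaf T w) Bool.≟ true) (allSigns d))
           (∑-cong (allSigns d) (λ w → if-≟true (isNonzeroB ℝ (leaf T w)))))
    where
    if-≟true : ∀ b → (if does (b Bool.≟ true) then 1# else 0#) ≡ (if b then 1# else 0#)
    if-≟true true = refl
    if-≟true false = refl

  0≤density≤1 : ∀ {n d} (T : DTree ℝ n d) → 0# ≤ density ℝ T × density ℝ T ≤ 1#
  0≤density≤1 {d = d} T =
    *-nonneg (fromℕ-nonNeg (length (filter nonzero? (allSigns d)))) 0≤2^d⁻¹ ,
    (begin
      fromℕ ℝ (length (filter nonzero? (allSigns d))) * 2^ ℝ d ⁻¹
        ≤⟨ *-monoʳ-≤-nonNeg 0≤2^d⁻¹ (fromℕ-mono-≤ (length-filter nonzero? (allSigns d))) ⟩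
      fromℕ ℝ (length (allSigns d)) * 2^ ℝ d ⁻¹
        ≡⟨ cong (_* 2^ ℝ d ⁻¹) (fromℕ-length-allSigns d) ⟩
      2^ ℝ d * 2^ ℝ d ⁻¹
        ≡⟨ inverseʳ (2^ ℝ d) (2^≢0 d) ⟩
      1# ∎)
    where
    nonzero? = λ w → isNonzeroB ℝ (leaf T w) Bool.≟ true
    0≤2^d⁻¹ : 0# ≤ 2^ ℝ d ⁻¹
    0≤2^d⁻¹ = x⁻¹-nonNeg (≤-trans 0≤1 (1≤2^ d)) (2^≢0 d)

  module _ {n : ℕ} where

    nonzeroIndicator-constPoly-≢0 : ∀ {c} → c ≢ 0# → nonzeroIndicator (constPoly {n} c) ≡ 1#
    nonzeroIndicator-constPoly-≢0 {c} c≢0 = cong (if_then 1# else 0#)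
      (isNonzeroB-≢0 (constPoly {n} c) ⊥ (λ c⊥≡0 → c≢0 (trans (sym (c⊙δ-self {n} c ⊥)) c⊥≡0)))

    nonzeroIndicator-constPoly-≡0 : ∀ {c} → c ≡ 0# → nonzeroIndicator (constPoly {n} c) ≡ 0#
    nonzeroIndicator-constPoly-≡0 refl =
      cong (if_then 1# else 0#) (isNonzeroB-≡0 (constPoly {n} 0#) (λ Z → zeroˡ _))

    ∑-nonzeroIndicator-rounded : ∀ {a r : Poly ℝ n} → RoundsTo a r →
      ∑ (allSubsets n) (λ S → nonzeroIndicator (constPoly {n} (r S))) ≡ nonzeroIndicator a
    ∑-nonzeroIndicator-rounded {a} (inj₁ (a≡0 , r≡0)) =
      trans (∑-zero (allSubsets n) (λ S → nonzeroIndicator-constPoly-≡0 (r≡0 S)))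
            (sym (cong (if_then 1# else 0#) (isNonzeroB-≡0 a a≡0)))
    ∑-nonzeroIndicator-rounded {a} {r} (inj₂ (S* , σ , aS*≢0 , σ-sign , r≗)) = begin-equality
      ∑ (allSubsets n) (λ S → nonzeroIndicator (constPoly {n} (r S)))
        ≡⟨ ∑-cong (allSubsets n) at ⟩
      ∑ (allSubsets n) (λ S → 1# * δ S* S)
        ≡⟨ ∑-*δ S* (λ _ → 1#) ⟩
      1#
        ≡⟨ cong (if_then 1# else 0#) (isNonzeroB-≢0 a S* aS*≢0) ⟨
      nonzeroIndicator a ∎
      where
      at : ∀ S → nonzeroIndicator (constPoly {n} (r S)) ≡ 1# * δ S* S
      at S with S* ≟ₛ S
      ... | yes refl =
        trans (nonzeroIndicator-constPoly-≢0 (±1≢0 σ-sign ∘ trans (sym (trans (r≗ S) (c⊙δ-self σ S)))))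
              (sym (*-identityˡ 1#))
      ... | no S*≢S =
        trans (nonzeroIndicator-constPoly-≡0 (trans (r≗ S) (c⊙δ-other σ S*≢S))) (sym (zeroʳ 1#))

  -- The trees U_S

  module _ {X : Set} (f : X → Carrier) where

    0≤foldr-⊔ : ∀ xs → 0# ≤ foldr (λ x acc → f x ⊔ acc) 0# xs
    0≤foldr-⊔ [] = ≤-refl
    0≤foldr-⊔ (x ∷ xs) = ≤-trans (0≤foldr-⊔ xs) (y≤x⊔y _ _)

    ∈⇒≤foldr-⊔ : ∀ {x xs} → x ∈ xs → f x ≤ foldr (λ x acc → f x ⊔ acc) 0# xs
    ∈⇒≤foldr-⊔ (here refl) = x≤x⊔y _ _
    ∈⇒≤foldr-⊔ (there x∈xs) = ≤-trans (∈⇒≤foldr-⊔ x∈xs) (y≤x⊔y _ _)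

  sumFin-lookup : ∀ {X : Set} (xs : List X) {N} (len≡N : length xs ≡ N) (f : X → Carrier) →
    sumFin ℝ N (λ i → f (List.lookup xs (cast (sym len≡N) i))) ≡ ∑ xs f
  sumFin-lookup xs refl f = begin-equality
    ∑ (allFin (length xs)) (λ i → f (List.lookup xs (cast refl i)))
      ≡⟨ ∑-cong (allFin (length xs)) (λ i → cong (f ∘ List.lookup xs) (cast-is-id refl i)) ⟩
    sumList ℝ (map (f ∘ List.lookup xs) (List.tabulate (λ i → i)))
      ≡⟨ cong (sumList ℝ) (map-tabulate (λ i → i) (f ∘ List.lookup xs)) ⟩
    sumList ℝ (List.tabulate (f ∘ List.lookup xs))
      ≡⟨ cong (sumList ℝ) (map-tabulate (List.lookup xs) f) ⟨
    sumList ℝ (map f (List.tabulate (List.lookup xs)))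
      ≡⟨ cong (sumList ℝ ∘ map f) (tabulate-lookup xs) ⟩
    ∑ xs f ∎

  module Construction {n d k p} (T : DTree ℝ n d) (T∈𝒯 : InT ℝ T p k) (𝒮 : Subset d → Bool) where
    open Restriction T 𝒮
    open RoundingFamilies {n} (≡-dec _≟Sign_) G G-linear

    m : Carrier
    m = maxLeafNorm ℝ T

    0≤m : 0# ≤ m
    0≤m = 0≤foldr-⊔ (λ w → ‖ leaf T w ‖₁) (allSigns d)

    ‖leaf‖₁≤m : ∀ w → ‖ leaf T w ‖₁ ≤ m
    ‖leaf‖₁≤m w = ∈⇒≤foldr-⊔ (λ w → ‖ leaf T w ‖₁) (∈-allSigns w)

    m≡0⇒coefficient≡0 : m ≡ 0# → ∀ S w → coefficient S w ≡ 0#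
    m≡0⇒coefficient≡0 m≡0 S w = ∣x∣≡0⇒x≡0 (≤-antisym
      (≤-trans (∣φS∣≤‖φ‖₁ (leaf T w) S) (subst (‖ leaf T w ‖₁ ≤_) m≡0 (‖leaf‖₁≤m w)))
      (0≤∣x∣ (coefficient S w)))

    -- For m = 0 the value of m ⁻¹ is unspecified, but then every coefficient is 0 anyway.
    normalised : Family
    normalised S w = m ⁻¹ * coefficient S w

    coefficient≡m*normalised : ∀ S w → coefficient S w ≡ m * normalised S w
    coefficient≡m*normalised S w with m ≟ 0#
    ... | no m≢0 = sym (x*x⁻¹*y≡y (coefficient S w) m≢0)
    ... | yes m≡0 =
      trans (m≡0⇒coefficient≡0 m≡0 S w) (sym (trans (cong (_* normalised S w) m≡0) (zeroˡ _)))

    ‖normalised-row‖₁≤1 : ∀ w → ‖ row normalised w ‖₁ ≤ 1#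
    ‖normalised-row‖₁≤1 w with m ≟ 0#
    ... | yes m≡0 = ≤-trans (≤-reflexive (∑-zero (allSubsets n) λ S →
      trans (cong (λ c → ∣ m ⁻¹ * c ∣) (m≡0⇒coefficient≡0 m≡0 S w)) (trans (cong ∣_∣ (zeroʳ _)) ∣0∣≡0))) 0≤1
    ... | no m≢0 = begin
      ‖ m ⁻¹ ⊙ leaf T w ‖₁      ≡⟨ ‖a⊙φ‖₁≡∣a∣‖φ‖₁ (m ⁻¹) (leaf T w) ⟩
      ∣ m ⁻¹ ∣ * ‖ leaf T w ‖₁  ≡⟨ cong (_* ‖ leaf T w ‖₁) (∣x∣≡x 0≤m⁻¹) ⟩
      m ⁻¹ * ‖ leaf T w ‖₁      ≤⟨ *-monoˡ-≤-nonNeg 0≤m⁻¹ (‖leaf‖₁≤m w) ⟩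
      m ⁻¹ * m                  ≡⟨ *-comm (m ⁻¹) m ⟩
      m * m ⁻¹                  ≡⟨ inverseʳ m m≢0 ⟩
      1#                        ∎
      where
      0≤m⁻¹ : 0# ≤ m ⁻¹
      0≤m⁻¹ = x⁻¹-nonNeg 0≤m m≢0

    normalised-sameZeros : ∀ w S → normalised S w ≡ 0# ⇔ coefficient S w ≡ 0#
    normalised-sameZeros w S = mk⇔
      (λ n≡0 → trans (coefficient≡m*normalised S w) (trans (cong (m *_) n≡0) (zeroʳ m)))
      (λ c≡0 → trans (cong (m ⁻¹ *_) c≡0) (zeroʳ _))

    F-coefficient : F coefficient ≡ m * F normalised
    F-coefficient = trans (∑-cong (allSubsets n) λ S → begin-equality
        ‖ G (coefficient S) ‖₁     ≡⟨ ‖‖₁-cong (G-scale (normalised S) (coefficient S) m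
                                                        (coefficient≡m*normalised S)) ⟩
        ‖ m ⊙ G (normalised S) ‖₁  ≡⟨ ‖a⊙φ‖₁≡∣a∣‖φ‖₁ m (G (normalised S)) ⟩
        ∣ m ∣ * ‖ G (normalised S) ‖₁ ≡⟨ cong (_* ‖ G (normalised S) ‖₁) (∣x∣≡x 0≤m) ⟩
        m * ‖ G (normalised S) ‖₁  ∎)
      (∑-*ˡ (allSubsets n) m _)

    rounding : Σ Family λ e → F normalised ≤ F e × (∀ w → RoundsTo (leaf T w) (row e w))
    rounding with round-rows (allSigns d) normalised ‖normalised-row‖₁≤1
    ... | e , F≤ , _ , rounds =
      e , F≤ , λ w → RoundsTo-respˡ (normalised-sameZeros w) (rounds w (∈-allSigns w))

    e : Family
    e = proj₁ rounding

    rounded : ∀ w → RoundsTo (leaf T w) (row e w)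
    rounded = proj₂ (proj₂ rounding)

    U : Subset n → DTree ℝ n d
    U S = withConstantLeaves T (e S)

    sizeK : List (Subset n)
    sizeK = filter (ofSize k) (allSubsets n)

    e-vanishes-off-sizeK : ∀ S → ¬ Subset.∣ S ∣ ≡ k → ∀ w → e S w ≡ 0#
    e-vanishes-off-sizeK S ∣S∣≢k w with e S w ≟ 0#
    ... | yes eSw≡0 = eSw≡0
    ... | no eSw≢0 = ⊥-elim (∣S∣≢k (proj₂ T∈𝒯 w S (RoundsTo-support (rounded w) S eSw≢0)))

    U-in-𝒯* : ∀ S → InT* ℝ (U S) (density ℝ (U S)) 0
    U-in-𝒯* S = refl , λ w → leaf-shape (RoundsTo-entries (rounded w) S)
      where
      leaf-shape : ∀ {c} → c ≡ 0# ⊎ IsSign c →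
                   IsZeroPoly ℝ (constPoly {n} c) ⊎ SignedMonomial ℝ 0 (constPoly {n} c)
      leaf-shape (inj₁ refl) = inj₁ λ Z → zeroˡ _
      leaf-shape {c} (inj₂ c-sign) =
        inj₂ (⊥ , ∣⊥∣≡0 n , subst IsSign (sym (c⊙δ-self {n} c ⊥)) c-sign , λ Z Z≢⊥ → c⊙δ-other c (Z≢⊥ ∘ sym))

    density-sum : p ≡ ∑ sizeK (λ S → density ℝ (U S))
    density-sum = sym (begin-equality
      ∑ sizeK (λ S → density ℝ (U S))
        ≡⟨ ∑-cong sizeK (λ S → density≡∑ (U S)) ⟩
      ∑ sizeK (λ S → ∑ (allSigns d) (λ w → ν S w) * 2^ ℝ d ⁻¹)
        ≡⟨ ∑-*ʳ sizeK (2^ ℝ d ⁻¹) _ ⟩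
      ∑ sizeK (λ S → ∑ (allSigns d) (λ w → ν S w)) * 2^ ℝ d ⁻¹
        ≡⟨ cong (_* 2^ ℝ d ⁻¹) (∑-swap sizeK (allSigns d) ν) ⟩
      ∑ (allSigns d) (λ w → ∑ sizeK (λ S → ν S w)) * 2^ ℝ d ⁻¹
        ≡⟨ cong (_* 2^ ℝ d ⁻¹) (∑-cong (allSigns d) λ w →
             trans (∑-filter (ofSize k) (allSubsets n) _ (off-sizeK w)) (∑-nonzeroIndicator-rounded (rounded w))) ⟩
      ∑ (allSigns d) (λ w → nonzeroIndicator (leaf T w)) * 2^ ℝ d ⁻¹
        ≡⟨ density≡∑ T ⟨
      density ℝ T
        ≡⟨ proj₁ T∈𝒯 ⟩
      p ∎)
      where
      ν : Subset n → Vec Sign d → Carrier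
      ν S w = nonzeroIndicator (constPoly {n} (e S w))
      off-sizeK : ∀ w S → ¬ Subset.∣ S ∣ ≡ k → ν S w ≡ 0#
      off-sizeK w S ∣S∣≢k = nonzeroIndicator-constPoly-≡0 {n} (e-vanishes-off-sizeK S ∣S∣≢k w)

    norm-bound : ‖ restrict ℝ T 𝒮 ‖₁ ≤ m * ∑ sizeK (λ S → ‖ restrict ℝ (U S) 𝒮 ‖₁)
    norm-bound = begin
      ‖ restrict ℝ T 𝒮 ‖₁  ≤⟨ ‖restrict‖₁≤ ⟩
      F coefficient        ≡⟨ F-coefficient ⟩
      m * F normalised     ≤⟨ *-monoˡ-≤-nonNeg 0≤m (proj₁ (proj₂ rounding)) ⟩
      m * F e              ≡⟨ cong (m *_) (∑-filter (ofSize k) (allSubsets n) _ off-sizeK) ⟨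
      m * ∑ sizeK (λ S → ‖ restrict ℝ (U S) 𝒮 ‖₁) ∎
      where
      off-sizeK : ∀ S → ¬ Subset.∣ S ∣ ≡ k → ‖ G (e S) ‖₁ ≡ 0#
      off-sizeK S ∣S∣≢k = ∑-zero (allSubsets n) λ M →
        trans (cong ∣_∣ (G-zero (e S) (e-vanishes-off-sizeK S ∣S∣≢k) M)) ∣0∣≡0

lemma4p3 : (ℝ : Reals) → let open Reals ℝ in
    (n d k : ℕ) (p : Carrier) (T : DTree ℝ n d) → InT ℝ T p k →
    (𝒮 : Subset d → Bool) →
    Σ (Fin (n C k) → Carrier) λ ps →
    Σ ((i : Fin (n C k)) → DTree ℝ n d) λ Us →
      (∀ i → (0# ≤ ps i) × (ps i ≤ 1#)) ×
      (∀ i → InT* ℝ (Us i) (ps i) 0) ×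
      (p ≡ sumFin ℝ (n C k) ps) ×
      (‖_‖ ℝ (restrict ℝ T 𝒮) ≤
        maxLeafNorm ℝ T * sumFin ℝ (n C k) (λ i → ‖_‖ ℝ (restrict ℝ (Us i) 𝒮)))
lemma4p3 ℝ n d k p T T∈𝒯 𝒮 =
  density ℝ ∘ Us , Us , 0≤density≤1 ∘ Us , U-in-𝒯* ∘ enum ,
  trans density-sum (sym (reindex (density ℝ ∘ U))) ,
  subst (λ s → ‖ restrict ℝ T 𝒮 ‖₁ ≤ m * s) (sym (reindex (λ S → ‖ restrict ℝ (U S) 𝒮 ‖₁))) norm-bound
  where
  open Reals ℝ using (_≤_; _*_)
  open Rounding ℝ
  open Construction T T∈𝒯 𝒮

  enum : Fin (n C k) → Subset n
  enum i = List.lookup sizeK (cast (sym (length-ofSize n k)) i)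

  Us : Fin (n C k) → DTree ℝ n d
  Us = U ∘ enum

  reindex : ∀ f → sumFin ℝ (n C k) (f ∘ enum) ≡ ∑ sizeK f
  reindex = sumFin-lookup sizeK (length-ofSize n k)
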